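{- Let $p$ be a prime with $p \equiv 1 \pmod 6$. Then $M_n \equiv 0 \pmod p$ whenever $n = (pi+1)p^k - 2$ for some integers $i \geq 0$ and $k \geq 1$, and whenever $n = (pi + p - 1)p^k - 1$ for some integers $i \geq 0$ and $k \geq 1$.
   Context: The Motzkin numbers are $M_n = \sum_{k \geq 0} \binom{n}{2k} C_k$, where $C_k = \frac{1}{k+1}\binom{2k}{k}$ are the Catalan numbers. -}

module Defs where

open import Data.Nat using (ℕ; zero; suc; _+_; _*_; _/_)
open import Data.Nat.Combinatorics using (_C_)

-- Catalan number C_k = (1/(k+1)) * binom(2k, k)  (exact division in ℕ)
catalan : ℕ → ℕ
catalan k = ((2 * k) C k) / suc k

sumTo : ℕ → (ℕ → ℕ) → ℕ
sumTo zero    f = f 0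
sumTo (suc m) f = sumTo m f + f (suc m)

-- Motzkin number M_n = Σ_{k ≥ 0} binom(n, 2k) C_k ; terms with 2k > n vanish,
-- so summing k = 0..n covers all nonzero terms.
motzkin : ℕ → ℕ
motzkin n = sumTo n (λ k → (n C (2 * k)) * catalan k)

{-# OPTIONS --safe #-}
-- Writing Tₙ(e) for the coefficient of xᵉ in (1 + x + x²)ⁿ, the binomial expansion of
-- (x + (1 + x²))ⁿ gives Mₙ = Tₙ(n) − Tₙ(n + 2). Modulo p, Frobenius gives
-- (1 + x + x²)ᵖ ≡ 1 + xᵖ + x²ᵖ, hence (1 + x + x²)^(r + pm) ≡ (1 + xᵖ + x²ᵖ)ᵐ (1 + x + x²)ʳ, and for
-- r < p the coefficients of row r + pm near its centre are combinations of the two central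
-- coefficients Tₘ(m), Tₘ(m + 1) with coefficients from row r. For p = 3S + 1 the rows r = p − 1
-- and r = p − 2 are known modulo p up to degree p − 1, from (1 + x + x²)⁻¹ = (1 − x)/(1 − x³)
-- and its square. Appending a base-p digit p − 1 to m preserves Tₘ(m) and Tₘ(m + 1) modulo p.
-- For n + 2 = (pi + 1)pᵏ we have n = p − 2 + pm where m is obtained from pi by such digits and
-- T_{pi}(pi + 1) ≡ 0; then Mₙ ≡ −Tₘ(m + 1) ≡ 0. For n + 1 = (pi + p − 1)pᵏ we have n = p − 1 + pm
-- where m is obtained from p − 2 + pi, for which 2Tₘ(m) + Tₘ(m + 1) ≡ 0; then Mₙ ≡ 2Tₘ(m) + Tₘ(m + 1) ≡ 0.
module Submission where

open import Defs

-- Integer operators are opened only inside this block, so that the statement below can use those of ℕ.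
module _ where

  open import Data.Nat as ℕ using (ℕ; zero; suc)
  import Data.Nat.Properties as ℕ
  import Data.Nat.Tactic.RingSolver as ℕ-Solver
  open import Data.Nat.Combinatorics using (_C_; nCk+nC[k+1]≡[n+1]C[k+1]; k>n⇒nCk≡0; nCn≡1; nC1≡n)
  import Data.Nat.DivMod as ℕ
  open import Data.Nat.Primality using (Prime; euclidsLemma; ¬prime[1])
  import Data.Nat.Divisibility as ℕ
  open import Data.Integer using (ℤ; +_; -[1+_]; _+_; _*_; _-_; -_; _⊖_; 0ℤ; 1ℤ; -1ℤ; _≟_)
  import Data.Integer.Properties as ℤ
  open import Data.Integer.Tactic.RingSolver using (solve-∀)
  open import Data.Product using (∃; _×_; _,_; proj₁; proj₂)
  open import Data.Sum using (inj₁; inj₂)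
  open import Data.Empty using (⊥-elim)
  open import Relation.Nullary using (¬_; yes; no)
  open import Relation.Binary.PropositionalEquality
  open import Relation.Binary.Bundles using (Setoid)
  open import Data.Integer.Divisibility.Signed using (_∣_; divides; ∣⇒∣ᵤ; ∣m∣n⇒∣m+n; ∣m⇒∣-m; ∣n⇒∣m*n)
  import Relation.Binary.Reasoning.Setoid as SetoidReasoning

  -- Finite sums and the Kronecker delta

  ∑< : ℕ → (ℕ → ℤ) → ℤ
  ∑< zero    f = 0ℤ
  ∑< (suc n) f = f 0 + ∑< n (λ k → f (suc k))

  syntax ∑< n (λ k → e) = ∑[ k < n ] e

  ∑-cong : ∀ n {f g : ℕ → ℤ} → (∀ k → k ℕ.< n → f k ≡ g k) → ∑< n f ≡ ∑< n g
  ∑-cong zero    f≡g = refl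
  ∑-cong (suc n) f≡g = cong₂ _+_ (f≡g 0 (ℕ.s≤s ℕ.z≤n)) (∑-cong n (λ k k<n → f≡g (suc k) (ℕ.s≤s k<n)))

  ∑-distrib-+ : ∀ n (f g : ℕ → ℤ) → ∑[ k < n ] (f k + g k) ≡ ∑< n f + ∑< n g
  ∑-distrib-+ zero    f g = refl
  ∑-distrib-+ (suc n) f g = trans (cong (_+_ (f 0 + g 0)) (∑-distrib-+ n _ _)) (interchange (f 0) (g 0) _ _)
    where interchange : ∀ a b c d → a + b + (c + d) ≡ a + c + (b + d)
          interchange = solve-∀

  ∑-distrib-sub : ∀ n (f g : ℕ → ℤ) → ∑[ k < n ] (f k - g k) ≡ ∑< n f - ∑< n g
  ∑-distrib-sub zero    f g = refl
  ∑-distrib-sub (suc n) f g = trans (cong (_+_ (f 0 - g 0)) (∑-distrib-sub n _ _)) (interchange (f 0) (g 0) _ _)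
    where interchange : ∀ a b c d → a - b + (c - d) ≡ a + c - (b + d)
          interchange = solve-∀

  ∑-zero : ∀ n (f : ℕ → ℤ) → (∀ k → k ℕ.< n → f k ≡ 0ℤ) → ∑< n f ≡ 0ℤ
  ∑-zero zero    f f≡0 = refl
  ∑-zero (suc n) f f≡0 =
    cong₂ _+_ (f≡0 0 (ℕ.s≤s ℕ.z≤n)) (∑-zero n _ (λ k k<n → f≡0 (suc k) (ℕ.s≤s k<n)))

  ∑-split : ∀ m n (f : ℕ → ℤ) → ∑< (m ℕ.+ n) f ≡ ∑< m f + ∑[ k < n ] f (m ℕ.+ k)
  ∑-split zero    n f = sym (ℤ.+-identityˡ _)
  ∑-split (suc m) n f = trans (cong (_+_ (f 0)) (∑-split m n _)) (sym (ℤ.+-assoc (f 0) _ _))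

  ∑-last : ∀ n (f : ℕ → ℤ) → ∑< (suc n) f ≡ ∑< n f + f n
  ∑-last n f = begin
    ∑< (suc n) f                       ≡⟨ cong (λ m → ∑< m f) (ℕ.+-comm 1 n) ⟩
    ∑< (n ℕ.+ 1) f                     ≡⟨ ∑-split n 1 f ⟩
    ∑< n f + (f (n ℕ.+ 0) + 0ℤ)        ≡⟨ cong (_+_ (∑< n f)) (trans (ℤ.+-identityʳ _) (cong f (ℕ.+-identityʳ n))) ⟩
    ∑< n f + f n                       ∎
    where open ≡-Reasoning

  ∑-pad : ∀ m n (f : ℕ → ℤ) → (∀ k → m ℕ.≤ k → f k ≡ 0ℤ) → ∑< (m ℕ.+ n) f ≡ ∑< m f
  ∑-pad m n f f≡0 = begin
    ∑< (m ℕ.+ n) f                     ≡⟨ ∑-split m n f ⟩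
    ∑< m f + ∑[ k < n ] f (m ℕ.+ k)    ≡⟨ cong (_+_ (∑< m f)) (∑-zero n _ (λ k _ → f≡0 (m ℕ.+ k) (ℕ.m≤m+n m k))) ⟩
    ∑< m f + 0ℤ                        ≡⟨ ℤ.+-identityʳ _ ⟩
    ∑< m f                             ∎
    where open ≡-Reasoning

  ∑-pairs : ∀ n (f : ℕ → ℤ) → ∑< (n ℕ.+ n) f ≡ ∑[ k < n ] (f (k ℕ.+ k) + f (suc (k ℕ.+ k)))
  ∑-pairs zero    f = refl
  ∑-pairs (suc n) f = begin
    f 0 + ∑< (n ℕ.+ suc n) (λ k → f (suc k))
      ≡⟨ cong (λ m → f 0 + ∑< m (λ k → f (suc k))) (ℕ.+-suc n n) ⟩
    f 0 + (f 1 + ∑< (n ℕ.+ n) (λ k → f (2 ℕ.+ k)))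
      ≡⟨ sym (ℤ.+-assoc (f 0) (f 1) _) ⟩
    f 0 + f 1 + ∑< (n ℕ.+ n) (λ k → f (2 ℕ.+ k))
      ≡⟨ cong (_+_ (f 0 + f 1)) (∑-pairs n _) ⟩
    f 0 + f 1 + ∑[ k < n ] (f (2 ℕ.+ (k ℕ.+ k)) + f (3 ℕ.+ (k ℕ.+ k)))
      ≡⟨ cong (_+_ (f 0 + f 1)) (∑-cong n (λ k _ → cong₂ (λ i j → f i + f j) (shift k) (cong suc (shift k)))) ⟩
    f 0 + f 1 + ∑[ k < n ] (f (suc k ℕ.+ suc k) + f (suc (suc k ℕ.+ suc k))) ∎
    where
    open ≡-Reasoning
    shift : ∀ k → 2 ℕ.+ (k ℕ.+ k) ≡ suc k ℕ.+ suc k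
    shift k = cong suc (sym (ℕ.+-suc k k))

  δ : ℤ → ℤ → ℤ
  δ a b with a ≟ b
  ... | yes _ = 1ℤ
  ... | no  _ = 0ℤ

  δ-≡ : ∀ {a b} → a ≡ b → δ a b ≡ 1ℤ
  δ-≡ {a} {b} a≡b with a ≟ b
  ... | yes _   = refl
  ... | no  a≢b = ⊥-elim (a≢b a≡b)

  δ-≢ : ∀ {a b} → ¬ a ≡ b → δ a b ≡ 0ℤ
  δ-≢ {a} {b} a≢b with a ≟ b
  ... | yes a≡b = ⊥-elim (a≢b a≡b)
  ... | no  _   = refl

  δ-cong-⇔ : ∀ {a b c d} → (a ≡ b → c ≡ d) → (c ≡ d → a ≡ b) → δ a b ≡ δ c d
  δ-cong-⇔ {a} {b} to from with a ≟ b
  ... | yes a≡b = sym (δ-≡ (to a≡b))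
  ... | no  a≢b = sym (δ-≢ (λ c≡d → a≢b (from c≡d)))

  δ-shift : ∀ a b c → δ (a - c) b ≡ δ a (b + c)
  δ-shift a b c = δ-cong-⇔ (λ eq → trans (sym (cancel a c)) (cong (_+ c) eq)) (λ eq → trans (cong (_- c) eq) (cancel′ b c))
    where cancel : ∀ a c → a - c + c ≡ a
          cancel = solve-∀
          cancel′ : ∀ b c → b + c - c ≡ b
          cancel′ = solve-∀

  δ-swap : ∀ a b c → δ (a - b) c ≡ δ (a - c) b
  δ-swap a b c = trans (δ-shift a c b) (trans (cong (δ a) (ℤ.+-comm c b)) (sym (δ-shift a b c)))

  δ-shift₀ : ∀ a c → δ (a - c) 0ℤ ≡ δ a c
  δ-shift₀ a c = trans (δ-shift a 0ℤ c) (cong (δ a) (ℤ.+-identityˡ c))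

  +[1+m]-1≡+m : ∀ m → + suc m - 1ℤ ≡ + m
  +[1+m]-1≡+m m = trans (cong (_- 1ℤ) (ℤ.pos-+ 1 m)) (cancel (+ m))
    where cancel : ∀ x → 1ℤ + x - 1ℤ ≡ x
          cancel = solve-∀

  +[2+m]-2≡+m : ∀ m → + suc (suc m) - + 2 ≡ + m
  +[2+m]-2≡+m m = trans (cong (_- + 2) (ℤ.pos-+ 2 m)) (cancel (+ m))
    where cancel : ∀ x → + 2 + x - + 2 ≡ x
          cancel = solve-∀

  +[m+n]-+m≡+n : ∀ m n → + (m ℕ.+ n) - + m ≡ + n
  +[m+n]-+m≡+n m n = trans (cong (_- + m) (ℤ.pos-+ m n)) (cancel (+ m) (+ n))
    where cancel : ∀ x y → x + y - x ≡ y
          cancel = solve-∀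

  +m-+[m+1+n]≡-[1+n] : ∀ m n → + m - + (m ℕ.+ suc n) ≡ -[1+ n ]
  +m-+[m+1+n]≡-[1+n] m n = trans (cong (λ x → + m - x) (ℤ.pos-+ m (suc n))) (cancel (+ m) (+ suc n))
    where cancel : ∀ x y → x - (x + y) ≡ - y
          cancel = solve-∀

  -- Binomial coefficients

  pascal : ∀ n k → suc n C suc k ≡ n C k ℕ.+ n C suc k
  pascal n k = sym (nCk+nC[k+1]≡[n+1]C[k+1] n k)

  absorption : ∀ n k → suc k ℕ.* (suc n C suc k) ≡ suc n ℕ.* (n C k)
  absorption zero    zero    = refl
  absorption zero    (suc k) = ℕ.*-zeroʳ (suc (suc k))
  absorption (suc n) zero    = trans (ℕ.*-identityˡ _) (trans (nC1≡n (suc (suc n))) (sym (ℕ.*-identityʳ _)))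
  absorption (suc n) (suc k) = begin
    suc (suc k) ℕ.* (suc (suc n) C suc (suc k))         ≡⟨ cong (suc (suc k) ℕ.*_) (pascal (suc n) (suc k)) ⟩
    suc (suc k) ℕ.* (X ℕ.+ Y)                           ≡⟨ expand (suc k) X Y ⟩
    X ℕ.+ (suc k ℕ.* X ℕ.+ suc (suc k) ℕ.* Y)           ≡⟨ cong₂ (λ a b → X ℕ.+ (a ℕ.+ b)) (absorption n k) (absorption n (suc k)) ⟩
    X ℕ.+ (suc n ℕ.* (n C k) ℕ.+ suc n ℕ.* (n C suc k)) ≡⟨ cong (X ℕ.+_) (sym (ℕ.*-distribˡ-+ (suc n) (n C k) _)) ⟩
    X ℕ.+ suc n ℕ.* (n C k ℕ.+ n C suc k)               ≡⟨ cong (λ a → X ℕ.+ suc n ℕ.* a) (sym (pascal n k)) ⟩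
    suc (suc n) ℕ.* X                                   ∎
    where
    open ≡-Reasoning
    X = suc n C suc k
    Y = suc n C suc (suc k)
    expand : ∀ a x y → suc a ℕ.* (x ℕ.+ y) ≡ x ℕ.+ (a ℕ.* x ℕ.+ suc a ℕ.* y)
    expand = ℕ-Solver.solve-∀

  prime∣pCk : ∀ {p} → Prime p → ∀ k → 0 ℕ.< k → k ℕ.< p → p ℕ.∣ p C k
  prime∣pCk {suc q} p-prime (suc k) _ k<p
    with euclidsLemma (suc k) (suc q C suc k) p-prime (ℕ.divides (q C k) (trans (absorption q k) (ℕ.*-comm (suc q) _)))
  ... | inj₁ p∣k   = ⊥-elim (ℕ.<⇒≱ k<p (ℕ.∣⇒≤ p∣k))
  ... | inj₂ p∣pCk = p∣pCk

  catalan-difference : ∀ k → + catalan k ≡ + ((k ℕ.+ k) C k) - + ((k ℕ.+ k) C suc k)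
  catalan-difference k = begin
    + catalan k              ≡⟨ cong +_ catalan≡X∸Y ⟩
    + (X ℕ.∸ Y)              ≡⟨ sym (ℤ.⊖-≥ Y≤X) ⟩
    X ⊖ Y                    ≡⟨ sym (ℤ.m-n≡m⊖n X Y) ⟩
    + X - + Y                ∎
    where
    open ≡-Reasoning
    X = (k ℕ.+ k) C k
    Y = (k ℕ.+ k) C suc k
    [k+1]Y≡kX : suc k ℕ.* Y ≡ k ℕ.* X
    [k+1]Y≡kX = ℕ.+-cancelˡ-≡ (suc k ℕ.* X) _ _ (begin
      suc k ℕ.* X ℕ.+ suc k ℕ.* Y  ≡⟨ sym (ℕ.*-distribˡ-+ (suc k) X Y) ⟩
      suc k ℕ.* (X ℕ.+ Y)          ≡⟨ cong (suc k ℕ.*_) (sym (pascal (k ℕ.+ k) k)) ⟩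
      suc k ℕ.* (suc (k ℕ.+ k) C suc k) ≡⟨ absorption (k ℕ.+ k) k ⟩
      suc (k ℕ.+ k) ℕ.* X          ≡⟨ split k X ⟩
      suc k ℕ.* X ℕ.+ k ℕ.* X      ∎)
      where split : ∀ k x → suc (k ℕ.+ k) ℕ.* x ≡ suc k ℕ.* x ℕ.+ k ℕ.* x
            split = ℕ-Solver.solve-∀
    Y≤X : Y ℕ.≤ X
    Y≤X = ℕ.*-cancelˡ-≤ (suc k) (subst (ℕ._≤ suc k ℕ.* X) (sym [k+1]Y≡kX) (ℕ.*-monoˡ-≤ X (ℕ.n≤1+n k)))
    [X∸Y][k+1]≡X : (X ℕ.∸ Y) ℕ.* suc k ≡ X
    [X∸Y][k+1]≡X = begin
      (X ℕ.∸ Y) ℕ.* suc k              ≡⟨ ℕ.*-distribʳ-∸ (suc k) X Y ⟩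
      X ℕ.* suc k ℕ.∸ Y ℕ.* suc k      ≡⟨ cong₂ ℕ._∸_ (ℕ.*-suc X k) (trans (ℕ.*-comm Y (suc k)) [k+1]Y≡kX) ⟩
      X ℕ.+ X ℕ.* k ℕ.∸ k ℕ.* X        ≡⟨ cong (λ a → X ℕ.+ a ℕ.∸ k ℕ.* X) (ℕ.*-comm X k) ⟩
      X ℕ.+ k ℕ.* X ℕ.∸ k ℕ.* X        ≡⟨ ℕ.m+n∸n≡m X (k ℕ.* X) ⟩
      X                                ∎
    catalan≡X∸Y : catalan k ≡ X ℕ.∸ Y
    catalan≡X∸Y = begin
      ((2 ℕ.* k) C k) ℕ./ suc k        ≡⟨ cong (λ n → (n C k) ℕ./ suc k) (cong (k ℕ.+_) (ℕ.+-identityʳ k)) ⟩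
      X ℕ./ suc k                      ≡⟨ cong (ℕ._/ suc k) (sym [X∸Y][k+1]≡X) ⟩
      (X ℕ.∸ Y) ℕ.* suc k ℕ./ suc k    ≡⟨ ℕ.m*n/n≡m (X ℕ.∸ Y) (suc k) ⟩
      X ℕ.∸ Y                          ∎

  ∑-binomial-suc : ∀ n (f : ℕ → ℤ) →
    ∑[ i < suc (suc n) ] (+ (suc n C i) * f i) ≡ ∑[ i < suc n ] (+ (n C i) * f i) + ∑[ i < suc n ] (+ (n C i) * f (suc i))
  ∑-binomial-suc n f = begin
    + 1 * f 0 + ∑[ i < suc n ] (+ (suc n C suc i) * f (suc i))
      ≡⟨ cong (_+_ (+ 1 * f 0)) (∑-cong (suc n) (λ i _ → split i)) ⟩
    + 1 * f 0 + ∑[ i < suc n ] (+ (n C i) * f (suc i) + g i)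
      ≡⟨ cong (_+_ (+ 1 * f 0)) (∑-distrib-+ (suc n) (λ i → + (n C i) * f (suc i)) g) ⟩
    + 1 * f 0 + (shifted + ∑< (suc n) g)
      ≡⟨ cong (λ x → + 1 * f 0 + (shifted + x)) (∑-last n g) ⟩
    + 1 * f 0 + (shifted + (∑< n g + g n))
      ≡⟨ cong (λ x → + 1 * f 0 + (shifted + (∑< n g + x))) gn≡0 ⟩
    + 1 * f 0 + (shifted + (∑< n g + 0ℤ))
      ≡⟨ rearrange (+ 1 * f 0) shifted (∑< n g) ⟩
    + 1 * f 0 + ∑< n g + shifted ∎
    where
    open ≡-Reasoning
    shifted = ∑[ i < suc n ] (+ (n C i) * f (suc i))
    g : ℕ → ℤ
    g i = + (n C suc i) * f (suc i)
    split : ∀ i → + (suc n C suc i) * f (suc i) ≡ + (n C i) * f (suc i) + g i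
    split i = trans (cong (λ c → + c * f (suc i)) (pascal n i))
                    (trans (cong (_* f (suc i)) (ℤ.pos-+ (n C i) (n C suc i))) (ℤ.*-distribʳ-+ (f (suc i)) (+ (n C i)) (+ (n C suc i))))
    gn≡0 : g n ≡ 0ℤ
    gn≡0 = trans (cong (λ c → + c * f (suc n)) (k>n⇒nCk≡0 (ℕ.n<1+n n))) (ℤ.*-zeroˡ (f (suc n)))
    rearrange : ∀ a b c → a + (b + (c + 0ℤ)) ≡ a + c + b
    rearrange = solve-∀

  -- Trinomial coefficients and Motzkin numbers

  -- Polynomials are represented by their coefficient functions ℤ → ℤ: trinomial n e is the
  -- coefficient of x^e in (1 + x + x²)^n, and dilatedBinomial i s that of x^s in (1 + x²)^i.
  trinomial : ℕ → ℤ → ℤ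
  trinomial zero    e = δ e 0ℤ
  trinomial (suc n) e = trinomial n e + trinomial n (e - 1ℤ) + trinomial n (e - + 2)

  dilatedBinomial : ℕ → ℤ → ℤ
  dilatedBinomial zero    s = δ s 0ℤ
  dilatedBinomial (suc i) s = dilatedBinomial i s + dilatedBinomial i (s - + 2)

  central central₁ : ℕ → ℤ
  central  m = trinomial m (+ m)
  central₁ m = trinomial m (+ suc m)

  trinomial-neg : ∀ n k → trinomial n -[1+ k ] ≡ 0ℤ
  trinomial-neg zero    k = δ-≢ { -[1+ k ]} {0ℤ} (λ ())
  trinomial-neg (suc n) k
    rewrite trinomial-neg n k | trinomial-neg n (suc (k ℕ.+ 0)) | trinomial-neg n (suc (k ℕ.+ 1)) = refl

  trinomial-above : ∀ n e → n ℕ.+ n ℕ.< e → trinomial n (+ e) ≡ 0ℤ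
  trinomial-above zero    (suc e) _ = δ-≢ {+ suc e} {0ℤ} (λ ())
  trinomial-above (suc n) (suc (suc (suc e))) (ℕ.s≤s 2n+1<e+2) =
    vanish (ℕ.≤-pred (subst (ℕ._< suc (suc e)) (ℕ.+-suc n n) 2n+1<e+2))
    where
    vanish : n ℕ.+ n ℕ.< suc e → trinomial (suc n) (+ suc (suc (suc e))) ≡ 0ℤ
    vanish 2n<e+1
      rewrite +[1+m]-1≡+m (suc (suc e)) | +[2+m]-2≡+m (suc e)
            | trinomial-above n (suc (suc (suc e))) (ℕ.m<n⇒m<1+n (ℕ.m<n⇒m<1+n 2n<e+1))
            | trinomial-above n (suc (suc e)) (ℕ.m<n⇒m<1+n 2n<e+1)
            | trinomial-above n (suc e) 2n<e+1 = refl
  trinomial-above (suc n) (suc (suc zero)) (ℕ.s≤s (ℕ.s≤s 2n<0)) with subst (ℕ._≤ 0) (ℕ.+-suc n n) 2n<0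
  ... | ()

  trinomial-zero : ∀ n → trinomial n 0ℤ ≡ 1ℤ
  trinomial-zero zero    = refl
  trinomial-zero (suc n) rewrite trinomial-zero n | trinomial-neg n 0 | trinomial-neg n 1 = refl

  trinomial-symmetric : ∀ n d → trinomial n (+ n + d) ≡ trinomial n (+ n - d)
  trinomial-symmetric zero    d = δ-cong-⇔ (λ eq → trans (sym (negate d)) (cong -_ eq)) (λ eq → trans (negate′ d) (cong -_ eq))
    where negate : ∀ d → - (0ℤ + d) ≡ 0ℤ - d
          negate = solve-∀
          negate′ : ∀ d → 0ℤ + d ≡ - (0ℤ - d)
          negate′ = solve-∀
  trinomial-symmetric (suc n) d rewrite ℤ.pos-+ 1 n = begin
    T (1ℤ + N + d) + T (1ℤ + N + d - 1ℤ) + T (1ℤ + N + d - + 2)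
      ≡⟨ sum₃ (cong T (up N d)) (cong T (cancel N d)) (cong T (down N d)) ⟩
    T (N + (d + 1ℤ)) + T (N + d) + T (N + (d - 1ℤ))
      ≡⟨ sum₃ (trinomial-symmetric n (d + 1ℤ)) (trinomial-symmetric n d) (trinomial-symmetric n (d - 1ℤ)) ⟩
    T (N - (d + 1ℤ)) + T (N - d) + T (N - (d - 1ℤ))
      ≡⟨ reverse (T (N - (d + 1ℤ))) (T (N - d)) (T (N - (d - 1ℤ))) ⟩
    T (N - (d - 1ℤ)) + T (N - d) + T (N - (d + 1ℤ))
      ≡⟨ sym (sum₃ (cong T (up′ N d)) (cong T (cancel′ N d)) (cong T (down′ N d))) ⟩
    T (1ℤ + N - d) + T (1ℤ + N - d - 1ℤ) + T (1ℤ + N - d - + 2) ∎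
    where
    open ≡-Reasoning
    T = trinomial n
    N = + n
    sum₃ : ∀ {x y z x′ y′ z′ : ℤ} → x ≡ x′ → y ≡ y′ → z ≡ z′ → x + y + z ≡ x′ + y′ + z′
    sum₃ refl refl refl = refl
    reverse : ∀ a b c → a + b + c ≡ c + b + a
    reverse = solve-∀
    up : ∀ N d → 1ℤ + N + d ≡ N + (d + 1ℤ)
    up = solve-∀
    cancel : ∀ N d → 1ℤ + N + d - 1ℤ ≡ N + d
    cancel = solve-∀
    down : ∀ N d → 1ℤ + N + d - + 2 ≡ N + (d - 1ℤ)
    down = solve-∀
    up′ : ∀ N d → 1ℤ + N - d ≡ N - (d - 1ℤ)
    up′ = solve-∀
    cancel′ : ∀ N d → 1ℤ + N - d - 1ℤ ≡ N - d
    cancel′ = solve-∀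
    down′ : ∀ N d → 1ℤ + N - d - + 2 ≡ N - (d + 1ℤ)
    down′ = solve-∀

  dilatedBinomial-neg : ∀ i k → dilatedBinomial i -[1+ k ] ≡ 0ℤ
  dilatedBinomial-neg zero    k = δ-≢ { -[1+ k ]} {0ℤ} (λ ())
  dilatedBinomial-neg (suc i) k = cong₂ _+_ (dilatedBinomial-neg i k) (dilatedBinomial-neg i (suc (k ℕ.+ 1)))

  dilatedBinomial-even : ∀ i j → dilatedBinomial i (+ (j ℕ.+ j)) ≡ + (i C j)
  dilatedBinomial-even zero    zero    = refl
  dilatedBinomial-even zero    (suc j) = δ-≢ {+ (suc j ℕ.+ suc j)} {0ℤ} (λ ())
  dilatedBinomial-even (suc i) zero
    rewrite dilatedBinomial-neg i 1 | ℤ.+-identityʳ (dilatedBinomial i 0ℤ) = dilatedBinomial-even i 0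
  dilatedBinomial-even (suc i) (suc j) = begin
    dilatedBinomial i (+ (suc j ℕ.+ suc j)) + dilatedBinomial i (+ (suc j ℕ.+ suc j) - + 2)
      ≡⟨ cong (λ s → dilatedBinomial i (+ (suc j ℕ.+ suc j)) + dilatedBinomial i s) two-less ⟩
    dilatedBinomial i (+ (suc j ℕ.+ suc j)) + dilatedBinomial i (+ (j ℕ.+ j))
      ≡⟨ cong₂ _+_ (dilatedBinomial-even i (suc j)) (dilatedBinomial-even i j) ⟩
    + (i C suc j) + + (i C j)
      ≡⟨ sym (ℤ.pos-+ (i C suc j) (i C j)) ⟩
    + (i C suc j ℕ.+ i C j)
      ≡⟨ cong +_ (trans (ℕ.+-comm (i C suc j) (i C j)) (sym (pascal i j))) ⟩
    + (suc i C suc j) ∎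
    where
    open ≡-Reasoning
    two-less : + (suc j ℕ.+ suc j) - + 2 ≡ + (j ℕ.+ j)
    two-less = trans (cong (λ m → + suc m - + 2) (ℕ.+-suc j j)) (+[2+m]-2≡+m (j ℕ.+ j))

  dilatedBinomial-odd : ∀ i j → dilatedBinomial i (+ suc (j ℕ.+ j)) ≡ 0ℤ
  dilatedBinomial-odd zero    j = δ-≢ {+ suc (j ℕ.+ j)} {0ℤ} (λ ())
  dilatedBinomial-odd (suc i) zero = cong₂ _+_ (dilatedBinomial-odd i 0) (dilatedBinomial-neg i 0)
  dilatedBinomial-odd (suc i) (suc j) = cong₂ _+_ (dilatedBinomial-odd i (suc j)) (trans (cong (dilatedBinomial i) two-less) (dilatedBinomial-odd i j))
    where two-less : + suc (suc j ℕ.+ suc j) - + 2 ≡ + suc (j ℕ.+ j)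
          two-less = trans (cong (λ m → + suc (suc m) - + 2) (ℕ.+-suc j j)) (+[2+m]-2≡+m (suc (j ℕ.+ j)))

  dilatedBinomial-∑ : ∀ i s → dilatedBinomial i s ≡ ∑[ j < suc i ] (+ (i C j) * δ s (+ (j ℕ.+ j)))
  dilatedBinomial-∑ zero    s = sym (trans (ℤ.+-identityʳ _) (ℤ.*-identityˡ _))
  dilatedBinomial-∑ (suc i) s = begin
    dilatedBinomial i s + dilatedBinomial i (s - + 2)
      ≡⟨ cong₂ _+_ (dilatedBinomial-∑ i s) (dilatedBinomial-∑ i (s - + 2)) ⟩
    ∑[ j < suc i ] (+ (i C j) * δ s (+ (j ℕ.+ j))) + ∑[ j < suc i ] (+ (i C j) * δ (s - + 2) (+ (j ℕ.+ j)))
      ≡⟨ cong (_+_ (∑[ j < suc i ] (+ (i C j) * δ s (+ (j ℕ.+ j))))) (∑-cong (suc i) (λ j _ → cong (+ (i C j) *_) (shift j))) ⟩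
    ∑[ j < suc i ] (+ (i C j) * δ s (+ (j ℕ.+ j))) + ∑[ j < suc i ] (+ (i C j) * δ s (+ (suc j ℕ.+ suc j)))
      ≡⟨ sym (∑-binomial-suc i (λ j → δ s (+ (j ℕ.+ j)))) ⟩
    ∑[ j < suc (suc i) ] (+ (suc i C j) * δ s (+ (j ℕ.+ j))) ∎
    where
    open ≡-Reasoning
    shift : ∀ j → δ (s - + 2) (+ (j ℕ.+ j)) ≡ δ s (+ (suc j ℕ.+ suc j))
    shift j = trans (δ-shift s (+ (j ℕ.+ j)) (+ 2))
                    (cong (δ s) (trans (sym (ℤ.pos-+ (j ℕ.+ j) 2)) (cong +_ (2j+2≡2[j+1] j))))
      where 2j+2≡2[j+1] : ∀ j → j ℕ.+ j ℕ.+ 2 ≡ suc j ℕ.+ suc j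
            2j+2≡2[j+1] = ℕ-Solver.solve-∀

  -- (1 + x + x²)ⁿ = (x + (1 + x²))ⁿ, expanded by the binomial theorem.
  trinomial-expansion : ∀ n e → trinomial n e ≡ ∑[ i < suc n ] (+ (n C i) * dilatedBinomial i (e - (+ n - + i)))
  trinomial-expansion zero    e = sym (trans (ℤ.+-identityʳ _) (trans (ℤ.*-identityˡ _) (cong (λ s → δ s 0ℤ) (ℤ.+-identityʳ e))))
  trinomial-expansion (suc n) e = begin
    trinomial n e + trinomial n (e - 1ℤ) + trinomial n (e - + 2)
      ≡⟨ cong₂ (λ x y → x + y + trinomial n (e - + 2)) (trinomial-expansion n e) (trinomial-expansion n (e - 1ℤ)) ⟩
    F e + F (e - 1ℤ) + trinomial n (e - + 2)
      ≡⟨ cong (_+_ (F e + F (e - 1ℤ))) (trinomial-expansion n (e - + 2)) ⟩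
    F e + F (e - 1ℤ) + F (e - + 2)
      ≡⟨ rearrange (F e) (F (e - 1ℤ)) (F (e - + 2)) ⟩
    F (e - 1ℤ) + (F e + F (e - + 2))
      ≡⟨ cong (_+_ (F (e - 1ℤ))) (sym (∑-distrib-+ (suc n) (term e) (term (e - + 2)))) ⟩
    F (e - 1ℤ) + ∑[ i < suc n ] (term e i + term (e - + 2) i)
      ≡⟨ cong₂ _+_ (∑-cong (suc n) (λ i _ → cong (λ s → + (n C i) * dilatedBinomial i s) (shift₁ e (+ n) (+ i))))
                   (∑-cong (suc n) (λ i _ → combine i)) ⟩
    ∑[ i < suc n ] (+ (n C i) * G i) + ∑[ i < suc n ] (+ (n C i) * G (suc i))
      ≡⟨ sym (∑-binomial-suc n G) ⟩
    ∑[ i < suc (suc n) ] (+ (suc n C i) * G i) ∎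
    where
    open ≡-Reasoning
    term : ℤ → ℕ → ℤ
    term e i = + (n C i) * dilatedBinomial i (e - (+ n - + i))
    F : ℤ → ℤ
    F e = ∑< (suc n) (term e)
    G : ℕ → ℤ
    G i = dilatedBinomial i (e - (+ suc n - + i))
    rearrange : ∀ a b c → a + b + c ≡ b + (a + c)
    rearrange = solve-∀
    shift₁ : ∀ e n i → e - 1ℤ - (n - i) ≡ e - (1ℤ + n - i)
    shift₁ = solve-∀
    shift₀ : ∀ e n i → e - (n - i) ≡ e - (1ℤ + n - (1ℤ + i))
    shift₀ = solve-∀
    shift₂ : ∀ e n i → e - + 2 - (n - i) ≡ e - (1ℤ + n - (1ℤ + i)) - + 2
    shift₂ = solve-∀
    combine : ∀ i → term e i + term (e - + 2) i ≡ + (n C i) * G (suc i)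
    combine i = trans (sym (ℤ.*-distribˡ-+ (+ (n C i)) (dilatedBinomial i (e - (+ n - + i))) (dilatedBinomial i (e - + 2 - (+ n - + i)))))
                      (cong (λ x → + (n C i) * x) (cong₂ (λ s t → dilatedBinomial i s + dilatedBinomial i t) (shift₀ e (+ n) (+ i)) (shift₂ e (+ n) (+ i))))

  trinomial-central-difference : ∀ n → trinomial n (+ n) - trinomial n (+ (n ℕ.+ 2))
                                     ≡ ∑[ i < suc n ] (+ (n C i) * (dilatedBinomial i (+ i) - dilatedBinomial i (+ (i ℕ.+ 2))))
  trinomial-central-difference n = begin
    trinomial n (+ n) - trinomial n (+ (n ℕ.+ 2))
      ≡⟨ cong₂ _-_ (trinomial-expansion n (+ n)) (trinomial-expansion n (+ (n ℕ.+ 2))) ⟩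
    ∑[ i < suc n ] term (+ n) i - ∑[ i < suc n ] term (+ (n ℕ.+ 2)) i
      ≡⟨ sym (∑-distrib-sub (suc n) (term (+ n)) (term (+ (n ℕ.+ 2)))) ⟩
    ∑[ i < suc n ] (term (+ n) i - term (+ (n ℕ.+ 2)) i)
      ≡⟨ ∑-cong (suc n) (λ i _ → trans (cong₂ (λ s t → + (n C i) * dilatedBinomial i s - + (n C i) * dilatedBinomial i t)
                                                (cancel (+ n) (+ i)) (shift n i))
                                         (factor (+ (n C i)) _ _)) ⟩
    ∑[ i < suc n ] (+ (n C i) * (dilatedBinomial i (+ i) - dilatedBinomial i (+ (i ℕ.+ 2)))) ∎
    where
    open ≡-Reasoning
    term : ℤ → ℕ → ℤ
    term e i = + (n C i) * dilatedBinomial i (e - (+ n - + i))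
    cancel : ∀ n i → n - (n - i) ≡ i
    cancel = solve-∀
    factor : ∀ c x y → c * x - c * y ≡ c * (x - y)
    factor = solve-∀
    shift : ∀ n i → + (n ℕ.+ 2) - (+ n - + i) ≡ + (i ℕ.+ 2)
    shift n i = trans (cong (λ x → x - (+ n - + i)) (ℤ.pos-+ n 2))
                      (trans (cancel₂ (+ n) (+ i)) (sym (ℤ.pos-+ i 2)))
      where cancel₂ : ∀ n i → n + + 2 - (n - i) ≡ i + + 2
            cancel₂ = solve-∀

  dilatedBinomial-even-difference : ∀ k → dilatedBinomial (k ℕ.+ k) (+ (k ℕ.+ k)) - dilatedBinomial (k ℕ.+ k) (+ (k ℕ.+ k ℕ.+ 2))
                                        ≡ + catalan k
  dilatedBinomial-even-difference k = begin
    dilatedBinomial (k ℕ.+ k) (+ (k ℕ.+ k)) - dilatedBinomial (k ℕ.+ k) (+ (k ℕ.+ k ℕ.+ 2))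
      ≡⟨ cong (λ m → dilatedBinomial (k ℕ.+ k) (+ (k ℕ.+ k)) - dilatedBinomial (k ℕ.+ k) (+ m)) (2k+2≡[k+1]+[k+1] k) ⟩
    dilatedBinomial (k ℕ.+ k) (+ (k ℕ.+ k)) - dilatedBinomial (k ℕ.+ k) (+ (suc k ℕ.+ suc k))
      ≡⟨ cong₂ _-_ (dilatedBinomial-even (k ℕ.+ k) k) (dilatedBinomial-even (k ℕ.+ k) (suc k)) ⟩
    + ((k ℕ.+ k) C k) - + ((k ℕ.+ k) C suc k)
      ≡⟨ sym (catalan-difference k) ⟩
    + catalan k ∎
    where
    open ≡-Reasoning
    2k+2≡[k+1]+[k+1] : ∀ k → k ℕ.+ k ℕ.+ 2 ≡ suc k ℕ.+ suc k
    2k+2≡[k+1]+[k+1] = ℕ-Solver.solve-∀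

  dilatedBinomial-odd-difference : ∀ k → dilatedBinomial (suc (k ℕ.+ k)) (+ suc (k ℕ.+ k)) - dilatedBinomial (suc (k ℕ.+ k)) (+ (suc (k ℕ.+ k) ℕ.+ 2))
                                       ≡ 0ℤ
  dilatedBinomial-odd-difference k = begin
    dilatedBinomial (suc (k ℕ.+ k)) (+ suc (k ℕ.+ k)) - dilatedBinomial (suc (k ℕ.+ k)) (+ (suc (k ℕ.+ k) ℕ.+ 2))
      ≡⟨ cong (λ m → dilatedBinomial (suc (k ℕ.+ k)) (+ suc (k ℕ.+ k)) - dilatedBinomial (suc (k ℕ.+ k)) (+ m)) (2k+3≡2[k+1]+1 k) ⟩
    dilatedBinomial (suc (k ℕ.+ k)) (+ suc (k ℕ.+ k)) - dilatedBinomial (suc (k ℕ.+ k)) (+ suc (suc k ℕ.+ suc k))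
      ≡⟨ cong₂ _-_ (dilatedBinomial-odd (suc (k ℕ.+ k)) k) (dilatedBinomial-odd (suc (k ℕ.+ k)) (suc k)) ⟩
    0ℤ ∎
    where
    open ≡-Reasoning
    2k+3≡2[k+1]+1 : ∀ k → suc (k ℕ.+ k) ℕ.+ 2 ≡ suc (suc k ℕ.+ suc k)
    2k+3≡2[k+1]+1 = ℕ-Solver.solve-∀

  sumTo-∑ : ∀ n f → + sumTo n f ≡ ∑[ k < suc n ] (+ f k)
  sumTo-∑ zero    f = sym (ℤ.+-identityʳ _)
  sumTo-∑ (suc n) f = begin
    + (sumTo n f ℕ.+ f (suc n))         ≡⟨ ℤ.pos-+ (sumTo n f) (f (suc n)) ⟩
    + sumTo n f + + f (suc n)           ≡⟨ cong (_+ + f (suc n)) (sumTo-∑ n f) ⟩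
    ∑[ k < suc n ] (+ f k) + + f (suc n)  ≡⟨ sym (∑-last (suc n) (λ k → + f k)) ⟩
    ∑[ k < suc (suc n) ] (+ f k)          ∎
    where open ≡-Reasoning

  -- In the expansion, odd i contribute nothing and i = 2k contributes C(2k, k) − C(2k, k + 1) = Cₖ.
  motzkin-trinomial : ∀ n → + motzkin n ≡ trinomial n (+ n) - trinomial n (+ (n ℕ.+ 2))
  motzkin-trinomial n = sym (begin
    trinomial n (+ n) - trinomial n (+ (n ℕ.+ 2))
      ≡⟨ trinomial-central-difference n ⟩
    ∑< (suc n) g
      ≡⟨ sym (∑-pad (suc n) (suc n) g (λ i n<i → trans (cong (λ c → + c * difference i) (k>n⇒nCk≡0 n<i)) (ℤ.*-zeroˡ (difference i)))) ⟩
    ∑< (suc n ℕ.+ suc n) g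
      ≡⟨ ∑-pairs (suc n) g ⟩
    ∑[ k < suc n ] (g (k ℕ.+ k) + g (suc (k ℕ.+ k)))
      ≡⟨ ∑-cong (suc n) (λ k _ → pair k) ⟩
    ∑[ k < suc n ] (+ ((n C (2 ℕ.* k)) ℕ.* catalan k))
      ≡⟨ sym (sumTo-∑ n (λ k → (n C (2 ℕ.* k)) ℕ.* catalan k)) ⟩
    + motzkin n ∎)
    where
    open ≡-Reasoning
    difference : ℕ → ℤ
    difference i = dilatedBinomial i (+ i) - dilatedBinomial i (+ (i ℕ.+ 2))
    g : ℕ → ℤ
    g i = + (n C i) * difference i
    pair : ∀ k → g (k ℕ.+ k) + g (suc (k ℕ.+ k)) ≡ + ((n C (2 ℕ.* k)) ℕ.* catalan k)
    pair k = begin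
      g (k ℕ.+ k) + g (suc (k ℕ.+ k))
        ≡⟨ cong₂ (λ x y → + (n C (k ℕ.+ k)) * x + + (n C suc (k ℕ.+ k)) * y)
                 (dilatedBinomial-even-difference k) (dilatedBinomial-odd-difference k) ⟩
      + (n C (k ℕ.+ k)) * + catalan k + + (n C suc (k ℕ.+ k)) * 0ℤ
        ≡⟨ cong (_+_ (+ (n C (k ℕ.+ k)) * + catalan k)) (ℤ.*-zeroʳ (+ (n C suc (k ℕ.+ k)))) ⟩
      + (n C (k ℕ.+ k)) * + catalan k + 0ℤ
        ≡⟨ trans (ℤ.+-identityʳ _) (sym (ℤ.pos-* (n C (k ℕ.+ k)) (catalan k))) ⟩
      + ((n C (k ℕ.+ k)) ℕ.* catalan k)
        ≡⟨ cong (λ m → + ((n C m) ℕ.* catalan k)) (cong (k ℕ.+_) (sym (ℕ.+-identityʳ k))) ⟩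
      + ((n C (2 ℕ.* k)) ℕ.* catalan k) ∎

  -- Congruences

  module Congruence (m : ℕ) where

    infix 4 _≈_
    record _≈_ (a b : ℤ) : Set where
      constructor congruent
      field divides-difference : + m ∣ a - b

    ≈-reflexive : ∀ {a b} → a ≡ b → a ≈ b
    ≈-reflexive {a} refl = congruent (divides 0ℤ (ℤ.+-inverseʳ a))

    ≈-sym : ∀ {a b} → a ≈ b → b ≈ a
    ≈-sym {a} {b} (congruent m∣a-b) = congruent (subst (+ m ∣_) (negate a b) (∣m⇒∣-m m∣a-b))
      where negate : ∀ a b → - (a - b) ≡ b - a
            negate = solve-∀

    ≈-trans : ∀ {a b c} → a ≈ b → b ≈ c → a ≈ c
    ≈-trans {a} {b} {c} (congruent m∣a-b) (congruent m∣b-c) =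
      congruent (subst (+ m ∣_) (telescope a b c) (∣m∣n⇒∣m+n m∣a-b m∣b-c))
      where telescope : ∀ a b c → (a - b) + (b - c) ≡ a - c
            telescope = solve-∀

    ≈-setoid : Setoid _ _
    ≈-setoid = record
      { Carrier = ℤ
      ; _≈_ = _≈_
      ; isEquivalence = record { refl = ≈-reflexive refl ; sym = ≈-sym ; trans = ≈-trans }
      }

    module ≈-Reasoning = SetoidReasoning ≈-setoid

    +-cong : ∀ {a b c d} → a ≈ b → c ≈ d → a + c ≈ b + d
    +-cong {a} {b} {c} {d} (congruent m∣a-b) (congruent m∣c-d) =
      congruent (subst (+ m ∣_) (regroup a b c d) (∣m∣n⇒∣m+n m∣a-b m∣c-d))
      where regroup : ∀ a b c d → (a - b) + (c - d) ≡ a + c - (b + d)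
            regroup = solve-∀

    +-congˡ : ∀ a {b c} → b ≈ c → a + b ≈ a + c
    +-congˡ a = +-cong (≈-reflexive {a} refl)

    +-congʳ : ∀ c {a b} → a ≈ b → a + c ≈ b + c
    +-congʳ c a≈b = +-cong a≈b (≈-reflexive {c} refl)

    -‿cong : ∀ {a b} → a ≈ b → - a ≈ - b
    -‿cong {a} {b} (congruent m∣a-b) = congruent (subst (+ m ∣_) (regroup a b) (∣m⇒∣-m m∣a-b))
      where regroup : ∀ a b → - (a - b) ≡ - a - - b
            regroup = solve-∀

    sub-cong : ∀ {a b c d} → a ≈ b → c ≈ d → a - c ≈ b - d
    sub-cong a≈b c≈d = +-cong a≈b (-‿cong c≈d)

    *-congˡ : ∀ k {a b} → a ≈ b → k * a ≈ k * b
    *-congˡ k {a} {b} (congruent m∣a-b) = congruent (subst (+ m ∣_) (factor k a b) (∣n⇒∣m*n k m∣a-b))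
      where factor : ∀ k a b → k * (a - b) ≡ k * a - k * b
            factor = solve-∀

    *-congʳ : ∀ k {a b} → a ≈ b → a * k ≈ b * k
    *-congʳ k {a} {b} a≈b = ≈-trans (≈-reflexive (ℤ.*-comm a k)) (≈-trans (*-congˡ k a≈b) (≈-reflexive (ℤ.*-comm k b)))

    multiple≈0 : ∀ k → k * + m ≈ 0ℤ
    multiple≈0 k = congruent (divides k (ℤ.+-identityʳ (k * + m)))

    ∑-cong-≈ : ∀ n {f g : ℕ → ℤ} → (∀ k → k ℕ.< n → f k ≈ g k) → ∑< n f ≈ ∑< n g
    ∑-cong-≈ zero    f≈g = ≈-reflexive refl
    ∑-cong-≈ (suc n) f≈g = +-cong (f≈g 0 (ℕ.s≤s ℕ.z≤n)) (∑-cong-≈ n (λ k k<n → f≈g (suc k) (ℕ.s≤s k<n)))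

    ≈0⇒∣ : ∀ {a} → + a ≈ 0ℤ → m ℕ.∣ a
    ≈0⇒∣ {a} (congruent m∣a-0) = ∣⇒∣ᵤ (subst (+ m ∣_) (ℤ.+-identityʳ (+ a)) m∣a-0)

  -- Frobenius and Lucas congruences

  -- dilatedTrinomial m is (1 + xᵖ + x²ᵖ)ᵐ and lucasProduct m r is (1 + xᵖ + x²ᵖ)ᵐ (1 + x + x²)ʳ.
  module Dilated (p : ℕ) where

    dilatedTrinomial : ℕ → ℤ → ℤ
    dilatedTrinomial m e = ∑[ t < suc (m ℕ.+ m) ] (trinomial m (+ t) * δ e (+ (p ℕ.* t)))

    lucasProduct : ℕ → ℕ → ℤ → ℤ
    lucasProduct m r e = ∑[ t < suc (m ℕ.+ m) ] (trinomial m (+ t) * trinomial r (e - + (p ℕ.* t)))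

    ∑-trinomial-pad : ∀ m c (g : ℕ → ℤ) →
      ∑[ t < suc (m ℕ.+ m) ℕ.+ c ] (trinomial m (+ t) * g t) ≡ ∑[ t < suc (m ℕ.+ m) ] (trinomial m (+ t) * g t)
    ∑-trinomial-pad m c g =
      ∑-pad (suc (m ℕ.+ m)) c _ (λ t 2m<t → trans (cong (_* g t) (trinomial-above m t 2m<t)) (ℤ.*-zeroˡ (g t)))

    lucasProduct-zero : ∀ m e → lucasProduct m 0 e ≡ dilatedTrinomial m e
    lucasProduct-zero m e = ∑-cong (suc (m ℕ.+ m)) (λ t _ → cong (trinomial m (+ t) *_) (δ-shift₀ e (+ (p ℕ.* t))))

    lucasProduct-suc : ∀ m r e → lucasProduct m (suc r) e ≡ lucasProduct m r e + lucasProduct m r (e - 1ℤ) + lucasProduct m r (e - + 2)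
    lucasProduct-suc m r e = begin
      lucasProduct m (suc r) e
        ≡⟨ ∑-cong R (λ t _ → distribute t) ⟩
      ∑[ t < R ] (term e t + term (e - 1ℤ) t + term (e - + 2) t)
        ≡⟨ ∑-distrib-+ R (λ t → term e t + term (e - 1ℤ) t) (term (e - + 2)) ⟩
      ∑[ t < R ] (term e t + term (e - 1ℤ) t) + ∑< R (term (e - + 2))
        ≡⟨ cong (_+ ∑< R (term (e - + 2))) (∑-distrib-+ R (term e) (term (e - 1ℤ))) ⟩
      lucasProduct m r e + lucasProduct m r (e - 1ℤ) + lucasProduct m r (e - + 2) ∎
      where
      open ≡-Reasoning
      R = suc (m ℕ.+ m)
      term : ℤ → ℕ → ℤ
      term e t = trinomial m (+ t) * trinomial r (e - + (p ℕ.* t))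
      swap₁ : ∀ e x → e - x - 1ℤ ≡ e - 1ℤ - x
      swap₁ = solve-∀
      swap₂ : ∀ e x → e - x - + 2 ≡ e - + 2 - x
      swap₂ = solve-∀
      distrib₃ : ∀ w a b c → w * (a + b + c) ≡ w * a + w * b + w * c
      distrib₃ = solve-∀
      distribute : ∀ t → trinomial m (+ t) * trinomial (suc r) (e - + (p ℕ.* t)) ≡ term e t + term (e - 1ℤ) t + term (e - + 2) t
      distribute t = trans (cong (λ x → trinomial m (+ t) * x)
                                 (cong₂ (λ a b → trinomial r (e - + (p ℕ.* t)) + trinomial r a + trinomial r b)
                                        (swap₁ e (+ (p ℕ.* t))) (swap₂ e (+ (p ℕ.* t)))))
                           (distrib₃ (trinomial m (+ t)) (trinomial r (e - + (p ℕ.* t)))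
                                     (trinomial r (e - 1ℤ - + (p ℕ.* t))) (trinomial r (e - + 2 - + (p ℕ.* t))))

    δ-dilate : ∀ e k t → δ e (+ (p ℕ.* (k ℕ.+ t))) ≡ δ (e - + (p ℕ.* k)) (+ (p ℕ.* t))
    δ-dilate e k t = sym (trans (δ-shift e (+ (p ℕ.* t)) (+ (p ℕ.* k)))
                                (cong (δ e) (trans (sym (ℤ.pos-+ (p ℕ.* t) (p ℕ.* k)))
                                                   (cong +_ (trans (ℕ.+-comm (p ℕ.* t) _) (sym (ℕ.*-distribˡ-+ p k t)))))))

    dilatedTrinomial-shift₁ : ∀ m e →
      ∑[ t < suc (suc m ℕ.+ suc m) ] (trinomial m (+ t - 1ℤ) * δ e (+ (p ℕ.* t))) ≡ dilatedTrinomial m (e - + p)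
    dilatedTrinomial-shift₁ m e = begin
      trinomial m -1ℤ * δ e (+ (p ℕ.* 0)) + ∑[ t < suc (m ℕ.+ suc m) ] (trinomial m (+ suc t - 1ℤ) * δ e (+ (p ℕ.* suc t)))
        ≡⟨ cong₂ _+_ (trans (cong (_* δ e (+ (p ℕ.* 0))) (trinomial-neg m 0)) (ℤ.*-zeroˡ (δ e (+ (p ℕ.* 0)))))
                     (∑-cong (suc (m ℕ.+ suc m)) (λ t _ → cong₂ (λ x y → trinomial m x * y) (+[1+m]-1≡+m t)
                                                                (trans (δ-dilate e 1 t) (cong (λ k → δ (e - + k) (+ (p ℕ.* t))) (ℕ.*-identityʳ p))))) ⟩
      0ℤ + ∑[ t < suc (m ℕ.+ suc m) ] (trinomial m (+ t) * δ (e - + p) (+ (p ℕ.* t)))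
        ≡⟨ trans (ℤ.+-identityˡ _) (cong (λ n → ∑< n (λ t → trinomial m (+ t) * δ (e - + p) (+ (p ℕ.* t)))) (length m)) ⟩
      ∑[ t < suc (m ℕ.+ m) ℕ.+ 1 ] (trinomial m (+ t) * δ (e - + p) (+ (p ℕ.* t)))
        ≡⟨ ∑-trinomial-pad m 1 (λ t → δ (e - + p) (+ (p ℕ.* t))) ⟩
      dilatedTrinomial m (e - + p) ∎
      where
      open ≡-Reasoning
      length : ∀ m → suc (m ℕ.+ suc m) ≡ suc (m ℕ.+ m) ℕ.+ 1
      length = ℕ-Solver.solve-∀

    dilatedTrinomial-shift₂ : ∀ m e →
      ∑[ t < suc (suc m ℕ.+ suc m) ] (trinomial m (+ t - + 2) * δ e (+ (p ℕ.* t))) ≡ dilatedTrinomial m (e - + (p ℕ.+ p))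
    dilatedTrinomial-shift₂ m e = begin
      trinomial m -[1+ 1 ] * δ e (+ (p ℕ.* 0)) + (trinomial m -1ℤ * δ e (+ (p ℕ.* 1)) + ∑[ t < m ℕ.+ suc m ] h (suc (suc t)))
        ≡⟨ cong₂ (λ x y → x + (y + ∑[ t < m ℕ.+ suc m ] h (suc (suc t))))
                 (trans (cong (_* δ e (+ (p ℕ.* 0))) (trinomial-neg m 1)) (ℤ.*-zeroˡ (δ e (+ (p ℕ.* 0)))))
                 (trans (cong (_* δ e (+ (p ℕ.* 1))) (trinomial-neg m 0)) (ℤ.*-zeroˡ (δ e (+ (p ℕ.* 1))))) ⟩
      0ℤ + (0ℤ + ∑[ t < m ℕ.+ suc m ] h (suc (suc t)))
        ≡⟨ trans (ℤ.+-identityˡ _) (ℤ.+-identityˡ _) ⟩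
      ∑[ t < m ℕ.+ suc m ] h (suc (suc t))
        ≡⟨ ∑-cong (m ℕ.+ suc m) (λ t _ → cong₂ (λ x y → trinomial m x * y) (+[2+m]-2≡+m t)
                                                (trans (δ-dilate e 2 t) (cong (λ k → δ (e - + k) (+ (p ℕ.* t))) (double p)))) ⟩
      ∑[ t < m ℕ.+ suc m ] (trinomial m (+ t) * δ (e - + (p ℕ.+ p)) (+ (p ℕ.* t)))
        ≡⟨ cong (λ n → ∑< n (λ t → trinomial m (+ t) * δ (e - + (p ℕ.+ p)) (+ (p ℕ.* t)))) (ℕ.+-suc m m) ⟩
      dilatedTrinomial m (e - + (p ℕ.+ p)) ∎
      where
      open ≡-Reasoning
      h : ℕ → ℤ
      h t = trinomial m (+ t - + 2) * δ e (+ (p ℕ.* t))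
      double : ∀ p → p ℕ.* 2 ≡ p ℕ.+ p
      double = ℕ-Solver.solve-∀

    dilatedTrinomial-suc : ∀ m e → dilatedTrinomial (suc m) e ≡ dilatedTrinomial m e + dilatedTrinomial m (e - + p) + dilatedTrinomial m (e - + (p ℕ.+ p))
    dilatedTrinomial-suc m e = begin
      dilatedTrinomial (suc m) e
        ≡⟨ ∑-cong R (λ t _ → distribute t) ⟩
      ∑[ t < R ] (h₀ t + h₁ t + h₂ t)
        ≡⟨ trans (∑-distrib-+ R (λ t → h₀ t + h₁ t) h₂) (cong (_+ ∑< R h₂) (∑-distrib-+ R h₀ h₁)) ⟩
      ∑< R h₀ + ∑< R h₁ + ∑< R h₂
        ≡⟨ cong₂ (λ x y → x + y + ∑< R h₂) sum₀ (dilatedTrinomial-shift₁ m e) ⟩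
      dilatedTrinomial m e + dilatedTrinomial m (e - + p) + ∑< R h₂
        ≡⟨ cong (_+_ (dilatedTrinomial m e + dilatedTrinomial m (e - + p))) (dilatedTrinomial-shift₂ m e) ⟩
      dilatedTrinomial m e + dilatedTrinomial m (e - + p) + dilatedTrinomial m (e - + (p ℕ.+ p)) ∎
      where
      open ≡-Reasoning
      R = suc (suc m ℕ.+ suc m)
      h₀ h₁ h₂ : ℕ → ℤ
      h₀ t = trinomial m (+ t) * δ e (+ (p ℕ.* t))
      h₁ t = trinomial m (+ t - 1ℤ) * δ e (+ (p ℕ.* t))
      h₂ t = trinomial m (+ t - + 2) * δ e (+ (p ℕ.* t))
      distribute : ∀ t → trinomial (suc m) (+ t) * δ e (+ (p ℕ.* t)) ≡ h₀ t + h₁ t + h₂ t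
      distribute t = trans (ℤ.*-distribʳ-+ (δ e (+ (p ℕ.* t))) (trinomial m (+ t) + trinomial m (+ t - 1ℤ)) (trinomial m (+ t - + 2)))
                           (cong (_+ h₂ t) (ℤ.*-distribʳ-+ (δ e (+ (p ℕ.* t))) (trinomial m (+ t)) (trinomial m (+ t - 1ℤ))))
      sum₀ : ∑< R h₀ ≡ dilatedTrinomial m e
      sum₀ = trans (cong (λ n → ∑< n h₀) (length m)) (∑-trinomial-pad m 2 (λ t → δ e (+ (p ℕ.* t))))
        where length : ∀ m → suc (suc m ℕ.+ suc m) ≡ suc (m ℕ.+ m) ℕ.+ 2
              length = ℕ-Solver.solve-∀

    lucasProduct-factor-below : ∀ m r j k → r ℕ.< p → k ℕ.< m →
      trinomial r (+ (r ℕ.+ p ℕ.* m ℕ.+ j) - + (p ℕ.* k)) ≡ 0ℤ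
    lucasProduct-factor-below m r j k r<p k<m with ℕ.m≤n⇒∃[o]m+o≡n k<m
    ... | d , refl = trans (cong (trinomial r) index) (trinomial-above r _ 2r<index)
      where
      index : + (r ℕ.+ p ℕ.* (suc k ℕ.+ d) ℕ.+ j) - + (p ℕ.* k) ≡ + (r ℕ.+ j ℕ.+ p ℕ.* suc d)
      index = trans (cong (λ x → + x - + (p ℕ.* k)) (regroup r p k j d)) (+[m+n]-+m≡+n (p ℕ.* k) _)
        where regroup : ∀ r p k j d → r ℕ.+ p ℕ.* (suc k ℕ.+ d) ℕ.+ j ≡ p ℕ.* k ℕ.+ (r ℕ.+ j ℕ.+ p ℕ.* suc d)
              regroup = ℕ-Solver.solve-∀
      2r<index : r ℕ.+ r ℕ.< r ℕ.+ j ℕ.+ p ℕ.* suc d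
      2r<index = ℕ.+-mono-≤-< (ℕ.m≤m+n r j) (ℕ.<-≤-trans r<p (ℕ.m≤m*n p (suc d)))

    lucasProduct-factor-above : ∀ m r j k → r ℕ.+ j ℕ.< p ℕ.+ p →
      trinomial r (+ (r ℕ.+ p ℕ.* m ℕ.+ j) - + (p ℕ.* (m ℕ.+ suc (suc k)))) ≡ 0ℤ
    lucasProduct-factor-above m r j k r+j<2p with ℕ.m≤n⇒∃[o]m+o≡n r+j<2p
    ... | d , 1+r+j+d≡2p = trans (cong (trinomial r) index) (trinomial-neg r (d ℕ.+ p ℕ.* k))
      where
      index : + (r ℕ.+ p ℕ.* m ℕ.+ j) - + (p ℕ.* (m ℕ.+ suc (suc k))) ≡ -[1+ d ℕ.+ p ℕ.* k ]
      index = trans (cong (λ x → + (r ℕ.+ p ℕ.* m ℕ.+ j) - + x) (begin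
          p ℕ.* (m ℕ.+ suc (suc k))                  ≡⟨ expand p m k ⟩
          p ℕ.* m ℕ.+ (p ℕ.+ p) ℕ.+ p ℕ.* k          ≡⟨ cong (λ x → p ℕ.* m ℕ.+ x ℕ.+ p ℕ.* k) (sym 1+r+j+d≡2p) ⟩
          p ℕ.* m ℕ.+ suc (r ℕ.+ j ℕ.+ d) ℕ.+ p ℕ.* k ≡⟨ regroup r j d p m k ⟩
          r ℕ.+ p ℕ.* m ℕ.+ j ℕ.+ suc (d ℕ.+ p ℕ.* k) ∎))
        (+m-+[m+1+n]≡-[1+n] (r ℕ.+ p ℕ.* m ℕ.+ j) (d ℕ.+ p ℕ.* k))
        where
        open ≡-Reasoning
        expand : ∀ p m k → p ℕ.* (m ℕ.+ suc (suc k)) ≡ p ℕ.* m ℕ.+ (p ℕ.+ p) ℕ.+ p ℕ.* k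
        expand = ℕ-Solver.solve-∀
        regroup : ∀ r j d p m k → p ℕ.* m ℕ.+ suc (r ℕ.+ j ℕ.+ d) ℕ.+ p ℕ.* k ≡ r ℕ.+ p ℕ.* m ℕ.+ j ℕ.+ suc (d ℕ.+ p ℕ.* k)
        regroup = ℕ-Solver.solve-∀

    -- For t ≠ m, m + 1 the index e − pt falls outside [0, 2r], the support of row r.
    lucasProduct-central : ∀ m r j → r ℕ.< p → r ℕ.+ j ℕ.< p ℕ.+ p →
      lucasProduct m r (+ (r ℕ.+ p ℕ.* m ℕ.+ j)) ≡ central m * trinomial r (+ (r ℕ.+ j)) + central₁ m * trinomial r (+ (r ℕ.+ j) - + p)
    lucasProduct-central m r j r<p r+j<2p = begin
      lucasProduct m r e
        ≡⟨ sym (∑-trinomial-pad m 1 (λ t → trinomial r (e - + (p ℕ.* t)))) ⟩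
      ∑< (suc (m ℕ.+ m) ℕ.+ 1) f
        ≡⟨ cong (λ n → ∑< n f) (length m) ⟩
      ∑< (m ℕ.+ suc (suc m)) f
        ≡⟨ ∑-split m (suc (suc m)) f ⟩
      ∑< m f + (f (m ℕ.+ 0) + (f (m ℕ.+ 1) + ∑[ k < m ] f (m ℕ.+ suc (suc k))))
        ≡⟨ cong₂ (λ x y → x + (f (m ℕ.+ 0) + (f (m ℕ.+ 1) + y))) (∑-zero m f below) (∑-zero m _ (λ k _ → above k)) ⟩
      0ℤ + (f (m ℕ.+ 0) + (f (m ℕ.+ 1) + 0ℤ))
        ≡⟨ cong₂ (λ x y → 0ℤ + (x + (y + 0ℤ))) at-m at-m+1 ⟩
      0ℤ + (a + (b + 0ℤ))
        ≡⟨ simplify a b ⟩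
      a + b ∎
      where
      open ≡-Reasoning
      e = + (r ℕ.+ p ℕ.* m ℕ.+ j)
      a = central m * trinomial r (+ (r ℕ.+ j))
      b = central₁ m * trinomial r (+ (r ℕ.+ j) - + p)
      f : ℕ → ℤ
      f t = trinomial m (+ t) * trinomial r (e - + (p ℕ.* t))
      length : ∀ m → suc (m ℕ.+ m) ℕ.+ 1 ≡ m ℕ.+ suc (suc m)
      length = ℕ-Solver.solve-∀
      simplify : ∀ a b → 0ℤ + (a + (b + 0ℤ)) ≡ a + b
      simplify = solve-∀
      below : ∀ k → k ℕ.< m → f k ≡ 0ℤ
      below k k<m = trans (cong (trinomial m (+ k) *_) (lucasProduct-factor-below m r j k r<p k<m)) (ℤ.*-zeroʳ (trinomial m (+ k)))
      above : ∀ k → f (m ℕ.+ suc (suc k)) ≡ 0ℤ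
      above k = trans (cong (trinomial m (+ (m ℕ.+ suc (suc k))) *_) (lucasProduct-factor-above m r j k r+j<2p)) (ℤ.*-zeroʳ (trinomial m (+ (m ℕ.+ suc (suc k)))))
      at-m : f (m ℕ.+ 0) ≡ a
      at-m = cong₂ (λ x y → trinomial m x * trinomial r y) (cong +_ (ℕ.+-identityʳ m))
               (trans (cong (λ x → + x - + (p ℕ.* (m ℕ.+ 0))) (regroup r p m j)) (+[m+n]-+m≡+n (p ℕ.* (m ℕ.+ 0)) (r ℕ.+ j)))
        where regroup : ∀ r p m j → r ℕ.+ p ℕ.* m ℕ.+ j ≡ p ℕ.* (m ℕ.+ 0) ℕ.+ (r ℕ.+ j)
              regroup = ℕ-Solver.solve-∀
      at-m+1 : f (m ℕ.+ 1) ≡ b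
      at-m+1 = cong₂ (λ x y → trinomial m x * trinomial r y) (cong +_ (ℕ.+-comm m 1))
                 (trans (cong₂ (λ x y → + x - + y) (regroup r p m j) (expand p m))
                        (trans (cong₂ _-_ (ℤ.pos-+ (p ℕ.* m) (r ℕ.+ j)) (ℤ.pos-+ (p ℕ.* m) p)) (cancel (+ (p ℕ.* m)) (+ (r ℕ.+ j)) (+ p))))
        where regroup : ∀ r p m j → r ℕ.+ p ℕ.* m ℕ.+ j ≡ p ℕ.* m ℕ.+ (r ℕ.+ j)
              regroup = ℕ-Solver.solve-∀
              expand : ∀ p m → p ℕ.* (m ℕ.+ 1) ≡ p ℕ.* m ℕ.+ p
              expand = ℕ-Solver.solve-∀
              cancel : ∀ a x y → a + x - (a + y) ≡ x - y
              cancel = solve-∀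

  module ModuloPrime (q : ℕ) (p-prime : Prime (suc q)) where

    p : ℕ
    p = suc q

    open Congruence p public
    open Dilated p public

    binomial-sum-prime : ∀ (f : ℕ → ℤ) → ∑[ i < suc p ] (+ (p C i) * f i) ≈ f 0 + f p
    binomial-sum-prime f = begin
      + 1 * f 0 + ∑[ i < p ] g i        ≡⟨ cong₂ _+_ (ℤ.*-identityˡ (f 0)) (∑-last q g) ⟩
      f 0 + (∑[ i < q ] g i + g q)      ≈⟨ +-congˡ (f 0) (+-congʳ (g q) (∑-cong-≈ q (λ i i<q → inner i i<q))) ⟩
      f 0 + (∑[ i < q ] 0ℤ + g q)       ≡⟨ cong (λ x → f 0 + (x + g q)) (∑-zero q (λ _ → 0ℤ) (λ _ _ → refl)) ⟩
      f 0 + (0ℤ + g q)                  ≡⟨ cong (_+_ (f 0)) (trans (ℤ.+-identityˡ (g q)) (cong (λ c → + c * f p) (nCn≡1 p))) ⟩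
      f 0 + + 1 * f p                   ≡⟨ cong (_+_ (f 0)) (ℤ.*-identityˡ (f p)) ⟩
      f 0 + f p                         ∎
      where
      open ≈-Reasoning
      g : ℕ → ℤ
      g i = + (p C suc i) * f (suc i)
      inner : ∀ i → i ℕ.< q → g i ≈ 0ℤ
      inner i i<q with prime∣pCk p-prime (suc i) (ℕ.s≤s ℕ.z≤n) (ℕ.s≤s i<q)
      ... | ℕ.divides c pCk≡cp = ≈-trans (≈-reflexive g≡multiple) (multiple≈0 (+ c * f (suc i)))
        where
        g≡multiple : g i ≡ + c * f (suc i) * + p
        g≡multiple = trans (cong (λ x → + x * f (suc i)) pCk≡cp)
                         (trans (cong (_* f (suc i)) (ℤ.pos-* c p)) (swap (+ c) (+ p) (f (suc i))))
          where swap : ∀ c p x → c * p * x ≡ c * x * p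
                swap = solve-∀

    dilatedBinomial-prime : ∀ s → dilatedBinomial p s ≈ δ s 0ℤ + δ s (+ (p ℕ.+ p))
    dilatedBinomial-prime s = ≈-trans (≈-reflexive (dilatedBinomial-∑ p s)) (binomial-sum-prime (λ j → δ s (+ (j ℕ.+ j))))

    trinomial-prime : ∀ e → trinomial p e ≈ δ e 0ℤ + δ e (+ p) + δ e (+ (p ℕ.+ p))
    trinomial-prime e = begin
      trinomial p e
        ≡⟨ trinomial-expansion p e ⟩
      ∑[ i < suc p ] (+ (p C i) * dilatedBinomial i (e - (+ p - + i)))
        ≈⟨ binomial-sum-prime (λ i → dilatedBinomial i (e - (+ p - + i))) ⟩
      δ (e - (+ p - 0ℤ)) 0ℤ + dilatedBinomial p (e - (+ p - + p))
        ≡⟨ cong₂ _+_ (trans (cong (λ x → δ (e - x) 0ℤ) (ℤ.+-identityʳ (+ p))) (δ-shift₀ e (+ p)))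
                     (cong (dilatedBinomial p) (cancel e (+ p))) ⟩
      δ e (+ p) + dilatedBinomial p e
        ≈⟨ +-congˡ (δ e (+ p)) (dilatedBinomial-prime e) ⟩
      δ e (+ p) + (δ e 0ℤ + δ e (+ (p ℕ.+ p)))
        ≡⟨ sym (ℤ.+-assoc (δ e (+ p)) (δ e 0ℤ) _) ⟩
      δ e (+ p) + δ e 0ℤ + δ e (+ (p ℕ.+ p))
        ≡⟨ cong (_+ δ e (+ (p ℕ.+ p))) (ℤ.+-comm (δ e (+ p)) (δ e 0ℤ)) ⟩
      δ e 0ℤ + δ e (+ p) + δ e (+ (p ℕ.+ p)) ∎
      where
      open ≈-Reasoning
      cancel : ∀ e p → e - (p - p) ≡ e
      cancel = solve-∀

    lucasProduct-prime : ∀ m e → lucasProduct m p e ≈ dilatedTrinomial m e + dilatedTrinomial m (e - + p) + dilatedTrinomial m (e - + (p ℕ.+ p))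
    lucasProduct-prime m e = begin
      lucasProduct m p e
        ≈⟨ ∑-cong-≈ R (λ t _ → *-congˡ (trinomial m (+ t)) (trinomial-prime (e - + (p ℕ.* t)))) ⟩
      ∑[ t < R ] (trinomial m (+ t) * (δ (e - + (p ℕ.* t)) 0ℤ + δ (e - + (p ℕ.* t)) (+ p) + δ (e - + (p ℕ.* t)) (+ (p ℕ.+ p))))
        ≡⟨ ∑-cong R (λ t _ → distribute t) ⟩
      ∑[ t < R ] (term e t + term (e - + p) t + term (e - + (p ℕ.+ p)) t)
        ≡⟨ ∑-distrib-+ R (λ t → term e t + term (e - + p) t) (term (e - + (p ℕ.+ p))) ⟩
      ∑[ t < R ] (term e t + term (e - + p) t) + dilatedTrinomial m (e - + (p ℕ.+ p))
        ≡⟨ cong (_+ dilatedTrinomial m (e - + (p ℕ.+ p))) (∑-distrib-+ R (term e) (term (e - + p))) ⟩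
      dilatedTrinomial m e + dilatedTrinomial m (e - + p) + dilatedTrinomial m (e - + (p ℕ.+ p)) ∎
      where
      open ≈-Reasoning
      R = suc (m ℕ.+ m)
      term : ℤ → ℕ → ℤ
      term e t = trinomial m (+ t) * δ e (+ (p ℕ.* t))
      distrib₃ : ∀ w a b c → w * (a + b + c) ≡ w * a + w * b + w * c
      distrib₃ = solve-∀
      distribute : ∀ t → trinomial m (+ t) * (δ (e - + (p ℕ.* t)) 0ℤ + δ (e - + (p ℕ.* t)) (+ p) + δ (e - + (p ℕ.* t)) (+ (p ℕ.+ p)))
                         ≡ term e t + term (e - + p) t + term (e - + (p ℕ.+ p)) t
      distribute t = trans (distrib₃ w (δ (e - + (p ℕ.* t)) 0ℤ) (δ (e - + (p ℕ.* t)) (+ p)) (δ (e - + (p ℕ.* t)) (+ (p ℕ.+ p))))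
        (cong₂ _+_ (cong₂ _+_ (cong (w *_) (δ-shift₀ e (+ (p ℕ.* t))))
                              (cong (w *_) (δ-swap e (+ (p ℕ.* t)) (+ p))))
                   (cong (w *_) (δ-swap e (+ (p ℕ.* t)) (+ (p ℕ.+ p)))))
        where w = trinomial m (+ t)

    trinomial-+-≈ : ∀ n m → (∀ e → trinomial n e ≈ dilatedTrinomial m e) → ∀ r e → trinomial (r ℕ.+ n) e ≈ lucasProduct m r e
    trinomial-+-≈ n m T≈ zero    e = ≈-trans (T≈ e) (≈-reflexive (sym (lucasProduct-zero m e)))
    trinomial-+-≈ n m T≈ (suc r) e =
      ≈-trans (+-cong (+-cong (trinomial-+-≈ n m T≈ r e) (trinomial-+-≈ n m T≈ r (e - 1ℤ))) (trinomial-+-≈ n m T≈ r (e - + 2)))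
              (≈-reflexive (sym (lucasProduct-suc m r e)))

    trinomial-p*-≈ : ∀ m e → trinomial (p ℕ.* m) e ≈ dilatedTrinomial m e
    trinomial-p*-≈ zero    e = ≈-reflexive (begin
      trinomial (p ℕ.* 0) e                ≡⟨ cong (λ n → trinomial n e) (ℕ.*-zeroʳ p) ⟩
      δ e 0ℤ                               ≡⟨ cong (δ e) (cong +_ (sym (ℕ.*-zeroʳ p))) ⟩
      δ e (+ (p ℕ.* 0))                    ≡⟨ sym (trans (ℤ.+-identityʳ _) (ℤ.*-identityˡ _)) ⟩
      dilatedTrinomial 0 e                 ∎)
      where open ≡-Reasoning
    trinomial-p*-≈ (suc m) e = begin
      trinomial (p ℕ.* suc m) e            ≡⟨ cong (λ n → trinomial n e) (ℕ.*-suc p m) ⟩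
      trinomial (p ℕ.+ p ℕ.* m) e          ≈⟨ trinomial-+-≈ (p ℕ.* m) m (trinomial-p*-≈ m) p e ⟩
      lucasProduct m p e                   ≈⟨ lucasProduct-prime m e ⟩
      dilatedTrinomial m e + dilatedTrinomial m (e - + p) + dilatedTrinomial m (e - + (p ℕ.+ p))
                                           ≡⟨ sym (dilatedTrinomial-suc m e) ⟩
      dilatedTrinomial (suc m) e           ∎
      where open ≈-Reasoning

    lucas : ∀ m r e → trinomial (r ℕ.+ p ℕ.* m) e ≈ lucasProduct m r e
    lucas m = trinomial-+-≈ (p ℕ.* m) m (trinomial-p*-≈ m)

    lucas-near-centre : ∀ m r d j → r ℕ.+ suc d ≡ p → j ℕ.≤ p →
      trinomial (r ℕ.+ p ℕ.* m) (+ (r ℕ.+ p ℕ.* m ℕ.+ j)) ≈ central m * trinomial r (+ r - + j) + central₁ m * trinomial r (+ j - + suc d)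
    lucas-near-centre m r d j r+1+d≡p j≤p = begin
      trinomial (r ℕ.+ p ℕ.* m) (+ (r ℕ.+ p ℕ.* m ℕ.+ j))
        ≈⟨ lucas m r _ ⟩
      lucasProduct m r (+ (r ℕ.+ p ℕ.* m ℕ.+ j))
        ≡⟨ lucasProduct-central m r j r<p r+j<2p ⟩
      central m * trinomial r (+ (r ℕ.+ j)) + central₁ m * trinomial r (+ (r ℕ.+ j) - + p)
        ≡⟨ cong₂ (λ x y → central m * x + central₁ m * trinomial r y) reflect shift ⟩
      central m * trinomial r (+ r - + j) + central₁ m * trinomial r (+ j - + suc d) ∎
      where
      open ≈-Reasoning
      r<p : r ℕ.< p
      r<p = subst (r ℕ.<_) r+1+d≡p (ℕ.m<m+n r (ℕ.s≤s ℕ.z≤n))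
      r+j<2p : r ℕ.+ j ℕ.< p ℕ.+ p
      r+j<2p = ℕ.+-mono-<-≤ r<p j≤p
      reflect : trinomial r (+ (r ℕ.+ j)) ≡ trinomial r (+ r - + j)
      reflect = trans (cong (trinomial r) (ℤ.pos-+ r j)) (trinomial-symmetric r (+ j))
      shift : + (r ℕ.+ j) - + p ≡ + j - + suc d
      shift = trans (cong₂ _-_ (ℤ.pos-+ r j) (trans (cong +_ (sym r+1+d≡p)) (ℤ.pos-+ r (suc d))))
                    (cancel (+ r) (+ j) (+ suc d))
        where cancel : ∀ r j d → r + j - (r + d) ≡ j - d
              cancel = solve-∀

    motzkin-near-centre : ∀ m r d → r ℕ.+ suc d ≡ p → 2 ℕ.≤ p →
      + motzkin (r ℕ.+ p ℕ.* m) ≈ central m * (trinomial r (+ r) - trinomial r (+ r - + 2)) - central₁ m * trinomial r (+ 2 - + suc d)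
    motzkin-near-centre m r d r+1+d≡p 2≤p = begin
      + motzkin n
        ≡⟨ motzkin-trinomial n ⟩
      trinomial n (+ n) - trinomial n (+ (n ℕ.+ 2))
        ≡⟨ cong (λ x → trinomial n (+ x) - trinomial n (+ (n ℕ.+ 2))) (sym (ℕ.+-identityʳ n)) ⟩
      trinomial n (+ (n ℕ.+ 0)) - trinomial n (+ (n ℕ.+ 2))
        ≈⟨ sub-cong (lucas-near-centre m r d 0 r+1+d≡p ℕ.z≤n) (lucas-near-centre m r d 2 r+1+d≡p 2≤p) ⟩
      central m * trinomial r (+ r - 0ℤ) + central₁ m * trinomial r -[1+ d ] - (central m * trinomial r (+ r - + 2) + central₁ m * trinomial r (+ 2 - + suc d))
        ≡⟨ cong₂ (λ x y → central m * trinomial r x + central₁ m * y - (central m * trinomial r (+ r - + 2) + central₁ m * trinomial r (+ 2 - + suc d)))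
                 (ℤ.+-identityʳ (+ r)) (trinomial-neg r d) ⟩
      central m * trinomial r (+ r) + central₁ m * 0ℤ - (central m * trinomial r (+ r - + 2) + central₁ m * trinomial r (+ 2 - + suc d))
        ≡⟨ regroup (central m) (central₁ m) _ _ _ ⟩
      central m * (trinomial r (+ r) - trinomial r (+ r - + 2)) - central₁ m * trinomial r (+ 2 - + suc d) ∎
      where
      open ≈-Reasoning
      n = r ℕ.+ p ℕ.* m
      regroup : ∀ a b x y z → a * x + b * 0ℤ - (a * y + b * z) ≡ a * (x - y) - b * z
      regroup = solve-∀

  -- Division by 1 + x + x²

  -- The coefficients of the power series h / (1 + x + x²).
  divideTrinomial : (ℕ → ℤ) → ℕ → ℤ
  divideTrinomial h zero          = h 0
  divideTrinomial h (suc zero)    = h 1 - h 0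
  divideTrinomial h (suc (suc e)) = h (suc (suc e)) - divideTrinomial h (suc e) - divideTrinomial h e

  trinomial-suc-+ : ∀ n e → trinomial (suc n) (+ suc (suc e)) ≡ trinomial n (+ suc (suc e)) + trinomial n (+ suc e) + trinomial n (+ e)
  trinomial-suc-+ n e = cong₂ (λ x y → trinomial n (+ suc (suc e)) + trinomial n x + trinomial n y) (+[1+m]-1≡+m (suc e)) (+[2+m]-2≡+m e)

  module _ (m : ℕ) where

    open Congruence m

    trinomial-≈-divide : ∀ n N h → (∀ e → e ℕ.≤ N → trinomial (suc n) (+ e) ≈ h e) →
                         ∀ e → e ℕ.≤ N → trinomial n (+ e) ≈ divideTrinomial h e
    trinomial-≈-divide n N h T≈h zero _ =
      ≈-trans (≈-reflexive (trans (trinomial-zero n) (sym (trinomial-zero (suc n))))) (T≈h 0 ℕ.z≤n)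
    trinomial-≈-divide n N h T≈h (suc zero) 1≤N = ≈-trans (≈-reflexive (isolate _ _)) (sub-cong
        (≈-trans (≈-reflexive (sym (cong (_+_ (trinomial n (+ 1) + trinomial n 0ℤ)) (trinomial-neg n 0)))) (T≈h 1 1≤N))
        (trinomial-≈-divide n N h T≈h 0 ℕ.z≤n))
      where isolate : ∀ a b → a ≡ a + b + 0ℤ - b
            isolate = solve-∀
    trinomial-≈-divide n N h T≈h (suc (suc e)) e+2≤N = ≈-trans (≈-reflexive (isolate _ _ _)) (sub-cong (sub-cong
        (≈-trans (≈-reflexive (sym (trinomial-suc-+ n e))) (T≈h (suc (suc e)) e+2≤N))
        (trinomial-≈-divide n N h T≈h (suc e) (ℕ.≤-trans (ℕ.n≤1+n (suc e)) e+2≤N)))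
        (trinomial-≈-divide n N h T≈h e (ℕ.≤-trans (ℕ.≤-trans (ℕ.n≤1+n e) (ℕ.n≤1+n (suc e))) e+2≤N)))
      where isolate : ∀ a b c → a ≡ a + b + c - b - c
            isolate = solve-∀

  oneSeries : ℕ → ℤ
  oneSeries zero    = 1ℤ
  oneSeries (suc _) = 0ℤ

  δ-oneSeries : ∀ e → δ (+ e) 0ℤ ≡ oneSeries e
  δ-oneSeries zero    = refl
  δ-oneSeries (suc e) = δ-≢ {+ suc e} {0ℤ} (λ ())

  trinomial⁻¹ trinomial⁻² : ℕ → ℤ
  trinomial⁻¹ = divideTrinomial oneSeries
  trinomial⁻² = divideTrinomial trinomial⁻¹

  -- (1 + x + x²)⁻¹ = (1 - x) / (1 - x³)
  trinomial⁻¹-3* : ∀ u → trinomial⁻¹ (3 ℕ.* u) ≡ 1ℤ × trinomial⁻¹ (1 ℕ.+ 3 ℕ.* u) ≡ -1ℤ × trinomial⁻¹ (2 ℕ.+ 3 ℕ.* u) ≡ 0ℤ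
  trinomial⁻¹-3* zero    = refl , refl , refl
  trinomial⁻¹-3* (suc u) = subst Values (sym (ℕ.*-suc 3 u)) (step (trinomial⁻¹-3* u))
    where
    Values : ℕ → Set
    Values v = trinomial⁻¹ v ≡ 1ℤ × trinomial⁻¹ (1 ℕ.+ v) ≡ -1ℤ × trinomial⁻¹ (2 ℕ.+ v) ≡ 0ℤ
    step : Values (3 ℕ.* u) → Values (3 ℕ.+ 3 ℕ.* u)
    step (_ , t₁ , t₂) = t₃ , t₄ , cong₂ (λ a b → 0ℤ - a - b) t₄ t₃
      where
      t₃ = cong₂ (λ a b → 0ℤ - a - b) t₂ t₁
      t₄ = cong₂ (λ a b → 0ℤ - a - b) t₃ t₂

  -- (1 + x + x²)⁻² = (1 - x)² / (1 - x³)²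
  trinomial⁻²-3* : ∀ u → trinomial⁻² (3 ℕ.* u) ≡ + suc u × trinomial⁻² (1 ℕ.+ 3 ℕ.* u) ≡ - (+ suc u + + suc u) × trinomial⁻² (2 ℕ.+ 3 ℕ.* u) ≡ + suc u
  trinomial⁻²-3* zero    = refl , refl , refl
  trinomial⁻²-3* (suc u) = subst (Values (suc u)) (sym (ℕ.*-suc 3 u)) (step (trinomial⁻²-3* u))
    where
    Values : ℕ → ℕ → Set
    Values k v = trinomial⁻² v ≡ + suc k × trinomial⁻² (1 ℕ.+ v) ≡ - (+ suc k + + suc k) × trinomial⁻² (2 ℕ.+ v) ≡ + suc k
    cycle = trinomial⁻¹-3* (suc u)
    one₃ : trinomial⁻¹ (3 ℕ.+ 3 ℕ.* u) ≡ 1ℤ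
    one₃ = subst (λ v → trinomial⁻¹ v ≡ 1ℤ) (ℕ.*-suc 3 u) (proj₁ cycle)
    one₄ : trinomial⁻¹ (4 ℕ.+ 3 ℕ.* u) ≡ -1ℤ
    one₄ = subst (λ v → trinomial⁻¹ (1 ℕ.+ v) ≡ -1ℤ) (ℕ.*-suc 3 u) (proj₁ (proj₂ cycle))
    one₅ : trinomial⁻¹ (5 ℕ.+ 3 ℕ.* u) ≡ 0ℤ
    one₅ = subst (λ v → trinomial⁻¹ (2 ℕ.+ v) ≡ 0ℤ) (ℕ.*-suc 3 u) (proj₂ (proj₂ cycle))
    up : ∀ s → 1ℤ - s - - (s + s) ≡ 1ℤ + s
    up = solve-∀
    down : ∀ s → -1ℤ - (1ℤ + s) - s ≡ - ((1ℤ + s) + (1ℤ + s))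
    down = solve-∀
    back : ∀ s → 0ℤ - - ((1ℤ + s) + (1ℤ + s)) - (1ℤ + s) ≡ 1ℤ + s
    back = solve-∀
    step : Values u (3 ℕ.* u) → Values (suc u) (3 ℕ.+ 3 ℕ.* u)
    step (_ , t₁ , t₂) = t₃ , t₄ , t₅
      where
      S = + suc u
      t₃ : trinomial⁻² (3 ℕ.+ 3 ℕ.* u) ≡ 1ℤ + S
      t₃ = trans (cong₂ (λ a b → a - trinomial⁻² (2 ℕ.+ 3 ℕ.* u) - b) one₃ t₁) (trans (cong (λ a → 1ℤ - a - - (S + S)) t₂) (up S))
      t₄ : trinomial⁻² (4 ℕ.+ 3 ℕ.* u) ≡ - ((1ℤ + S) + (1ℤ + S))
      t₄ = trans (cong₂ (λ a b → a - trinomial⁻² (3 ℕ.+ 3 ℕ.* u) - b) one₄ t₂) (trans (cong (λ a → -1ℤ - a - S) t₃) (down S))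
      t₅ : trinomial⁻² (5 ℕ.+ 3 ℕ.* u) ≡ 1ℤ + S
      t₅ = trans (cong₂ (λ a b → a - trinomial⁻² (4 ℕ.+ 3 ℕ.* u) - b) one₅ t₃) (trans (cong (λ a → 0ℤ - a - (1ℤ + S)) t₄) (back S))

  -- Primes p ≡ 1 (mod 3)

  DividesMotzkin₁ DividesMotzkin₂ : ℕ → Set
  DividesMotzkin₁ p = (i k : ℕ) → k ℕ.≥ 1 → p ℕ.∣ motzkin ((p ℕ.* i ℕ.+ 1) ℕ.* p ℕ.^ k ℕ.∸ 2)
  DividesMotzkin₂ p = (i k : ℕ) → k ℕ.≥ 1 → p ℕ.∣ motzkin ((p ℕ.* i ℕ.+ p ℕ.∸ 1) ℕ.* p ℕ.^ k ℕ.∸ 1)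

  module OneModThree (Q : ℕ) (p-prime : Prime (4 ℕ.+ 3 ℕ.* Q)) where

    w q : ℕ
    w = 2 ℕ.+ 3 ℕ.* Q
    q = suc w

    open ModuloPrime q p-prime

    U V : ℤ → ℤ
    U = trinomial q
    V = trinomial w

    -- S = (p − 1) / 3
    S : ℤ
    S = + suc Q

    trinomial-p-low : ∀ e → e ℕ.≤ q → trinomial p (+ e) ≈ oneSeries e
    trinomial-p-low e e≤q = ≈-trans (trinomial-prime (+ e)) (≈-reflexive (begin
      δ (+ e) 0ℤ + δ (+ e) (+ p) + δ (+ e) (+ (p ℕ.+ p)) ≡⟨ cong₂ (λ x y → δ (+ e) 0ℤ + x + y) (δ-≢ e≢p) (δ-≢ e≢2p) ⟩
      δ (+ e) 0ℤ + 0ℤ + 0ℤ                               ≡⟨ trans (ℤ.+-identityʳ _) (ℤ.+-identityʳ _) ⟩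
      δ (+ e) 0ℤ                                         ≡⟨ δ-oneSeries e ⟩
      oneSeries e                                        ∎))
      where
      open ≡-Reasoning
      e<p : e ℕ.< p
      e<p = ℕ.s≤s e≤q
      e≢p : ¬ + e ≡ + p
      e≢p eq = ℕ.<⇒≢ e<p (ℤ.+-injective eq)
      e≢2p : ¬ + e ≡ + (p ℕ.+ p)
      e≢2p eq = ℕ.<⇒≢ (ℕ.<-≤-trans e<p (ℕ.m≤m+n p p)) (ℤ.+-injective eq)

    U≈trinomial⁻¹ : ∀ e → e ℕ.≤ q → U (+ e) ≈ trinomial⁻¹ e
    U≈trinomial⁻¹ = trinomial-≈-divide p q q oneSeries trinomial-p-low

    V≈trinomial⁻² : ∀ e → e ℕ.≤ q → V (+ e) ≈ trinomial⁻² e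
    V≈trinomial⁻² = trinomial-≈-divide p w q trinomial⁻¹ U≈trinomial⁻¹

    U[q]≈1 : U (+ q) ≈ 1ℤ
    U[q]≈1 = ≈-trans (U≈trinomial⁻¹ q ℕ.≤-refl)
                     (≈-reflexive (subst (λ v → trinomial⁻¹ v ≡ 1ℤ) (ℕ.*-suc 3 Q) (proj₁ (trinomial⁻¹-3* (suc Q)))))

    U[q-1]≈0 : U (+ q - + 1) ≈ 0ℤ
    U[q-1]≈0 = ≈-trans (≈-reflexive (cong (U) (+[1+m]-1≡+m w)))
                       (≈-trans (U≈trinomial⁻¹ w (ℕ.n≤1+n w)) (≈-reflexive (proj₂ (proj₂ (trinomial⁻¹-3* Q)))))

    U[q-2]≈-1 : U (+ q - + 2) ≈ -1ℤ
    U[q-2]≈-1 = ≈-trans (≈-reflexive (cong (U) (+[2+m]-2≡+m (1 ℕ.+ 3 ℕ.* Q))))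
                        (≈-trans (U≈trinomial⁻¹ (1 ℕ.+ 3 ℕ.* Q) (ℕ.≤-trans (ℕ.n≤1+n _) (ℕ.n≤1+n w)))
                                 (≈-reflexive (proj₁ (proj₂ (trinomial⁻¹-3* Q)))))

    U[1]≈-1 : U (+ 1) ≈ -1ℤ
    U[1]≈-1 = U≈trinomial⁻¹ 1 (ℕ.s≤s ℕ.z≤n)

    V[w]≈S : V (+ w) ≈ S
    V[w]≈S = ≈-trans (V≈trinomial⁻² w (ℕ.n≤1+n w)) (≈-reflexive (proj₂ (proj₂ (trinomial⁻²-3* Q))))

    V[w-1]≈-2S : V (+ w - + 1) ≈ - (S + S)
    V[w-1]≈-2S = ≈-trans (≈-reflexive (cong (V) (+[1+m]-1≡+m (1 ℕ.+ 3 ℕ.* Q))))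
                         (≈-trans (V≈trinomial⁻² (1 ℕ.+ 3 ℕ.* Q) (ℕ.≤-trans (ℕ.n≤1+n _) (ℕ.n≤1+n w)))
                                  (≈-reflexive (proj₁ (proj₂ (trinomial⁻²-3* Q)))))

    V[w-2]≈S : V (+ w - + 2) ≈ S
    V[w-2]≈S = ≈-trans (≈-reflexive (cong (V) (+[2+m]-2≡+m (3 ℕ.* Q))))
                       (≈-trans (V≈trinomial⁻² (3 ℕ.* Q) (ℕ.≤-trans (ℕ.≤-trans (ℕ.n≤1+n _) (ℕ.n≤1+n _)) (ℕ.n≤1+n w)))
                                (≈-reflexive (proj₁ (trinomial⁻²-3* Q))))

    2≤p : 2 ℕ.≤ p
    2≤p = ℕ.s≤s (ℕ.s≤s ℕ.z≤n)

    central-append-p-1 : ∀ m → central (q ℕ.+ p ℕ.* m) ≈ central m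
    central-append-p-1 m = begin
      central (q ℕ.+ p ℕ.* m)
        ≡⟨ cong (λ x → trinomial (q ℕ.+ p ℕ.* m) (+ x)) (sym (ℕ.+-identityʳ _)) ⟩
      trinomial (q ℕ.+ p ℕ.* m) (+ (q ℕ.+ p ℕ.* m ℕ.+ 0))
        ≈⟨ lucas-near-centre m q 0 0 (ℕ.+-comm q 1) ℕ.z≤n ⟩
      central m * U (+ q - 0ℤ) + central₁ m * U -1ℤ
        ≡⟨ cong₂ (λ x y → central m * U x + central₁ m * y) (ℤ.+-identityʳ (+ q)) (trinomial-neg q 0) ⟩
      central m * U (+ q) + central₁ m * 0ℤ
        ≈⟨ +-congʳ (central₁ m * 0ℤ) (*-congˡ (central m) U[q]≈1) ⟩
      central m * 1ℤ + central₁ m * 0ℤ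
        ≡⟨ simplify (central m) (central₁ m) ⟩
      central m ∎
      where
      open ≈-Reasoning
      simplify : ∀ a b → a * 1ℤ + b * 0ℤ ≡ a
      simplify = solve-∀

    central₁-append-p-1 : ∀ m → central₁ (q ℕ.+ p ℕ.* m) ≈ central₁ m
    central₁-append-p-1 m = begin
      central₁ (q ℕ.+ p ℕ.* m)
        ≡⟨ cong (λ x → trinomial (q ℕ.+ p ℕ.* m) (+ x)) (ℕ.+-comm 1 _) ⟩
      trinomial (q ℕ.+ p ℕ.* m) (+ (q ℕ.+ p ℕ.* m ℕ.+ 1))
        ≈⟨ lucas-near-centre m q 0 1 (ℕ.+-comm q 1) (ℕ.s≤s ℕ.z≤n) ⟩
      central m * U (+ q - + 1) + central₁ m * U 0ℤ
        ≈⟨ +-cong (*-congˡ (central m) U[q-1]≈0) (≈-reflexive (cong (central₁ m *_) (trinomial-zero q))) ⟩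
      central m * 0ℤ + central₁ m * 1ℤ
        ≡⟨ simplify (central m) (central₁ m) ⟩
      central₁ m ∎
      where
      open ≈-Reasoning
      simplify : ∀ a b → a * 0ℤ + b * 1ℤ ≡ b
      simplify = solve-∀

    central₁-p* : ∀ i → central₁ (p ℕ.* i) ≈ 0ℤ
    central₁-p* i = begin
      central₁ (p ℕ.* i)
        ≡⟨ cong (λ x → trinomial (p ℕ.* i) (+ x)) (ℕ.+-comm 1 _) ⟩
      trinomial (p ℕ.* i) (+ (p ℕ.* i ℕ.+ 1))
        ≈⟨ lucas-near-centre i 0 q 1 refl (ℕ.s≤s ℕ.z≤n) ⟩
      central i * 0ℤ + central₁ i * 0ℤ
        ≡⟨ simplify (central i) (central₁ i) ⟩
      0ℤ ∎
      where
      open ≈-Reasoning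
      simplify : ∀ a b → a * 0ℤ + b * 0ℤ ≡ 0ℤ
      simplify = solve-∀

    central-append-p-2 : ∀ i → central (w ℕ.+ p ℕ.* i) ≈ central i * S
    central-append-p-2 i = begin
      central (w ℕ.+ p ℕ.* i)
        ≡⟨ cong (λ x → trinomial (w ℕ.+ p ℕ.* i) (+ x)) (sym (ℕ.+-identityʳ _)) ⟩
      trinomial (w ℕ.+ p ℕ.* i) (+ (w ℕ.+ p ℕ.* i ℕ.+ 0))
        ≈⟨ lucas-near-centre i w 1 0 (ℕ.+-comm w 2) ℕ.z≤n ⟩
      central i * V (+ w - 0ℤ) + central₁ i * V -[1+ 1 ]
        ≡⟨ cong₂ (λ x y → central i * V x + central₁ i * y) (ℤ.+-identityʳ (+ w)) (trinomial-neg w 1) ⟩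
      central i * V (+ w) + central₁ i * 0ℤ
        ≈⟨ +-congʳ (central₁ i * 0ℤ) (*-congˡ (central i) V[w]≈S) ⟩
      central i * S + central₁ i * 0ℤ
        ≡⟨ simplify (central i * S) (central₁ i) ⟩
      central i * S ∎
      where
      open ≈-Reasoning
      simplify : ∀ a b → a + b * 0ℤ ≡ a
      simplify = solve-∀

    central₁-append-p-2 : ∀ i → central₁ (w ℕ.+ p ℕ.* i) ≈ central i * - (S + S)
    central₁-append-p-2 i = begin
      central₁ (w ℕ.+ p ℕ.* i)
        ≡⟨ cong (λ x → trinomial (w ℕ.+ p ℕ.* i) (+ x)) (ℕ.+-comm 1 _) ⟩
      trinomial (w ℕ.+ p ℕ.* i) (+ (w ℕ.+ p ℕ.* i ℕ.+ 1))
        ≈⟨ lucas-near-centre i w 1 1 (ℕ.+-comm w 2) (ℕ.s≤s ℕ.z≤n) ⟩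
      central i * V (+ w - + 1) + central₁ i * V -1ℤ
        ≈⟨ +-cong (*-congˡ (central i) V[w-1]≈-2S) (≈-reflexive (cong (central₁ i *_) (trinomial-neg w 0))) ⟩
      central i * - (S + S) + central₁ i * 0ℤ
        ≡⟨ simplify (central i * - (S + S)) (central₁ i) ⟩
      central i * - (S + S) ∎
      where
      open ≈-Reasoning
      simplify : ∀ a b → a + b * 0ℤ ≡ a
      simplify = solve-∀

    motzkin-append-p-2 : ∀ m → central₁ m ≈ 0ℤ → + motzkin (w ℕ.+ p ℕ.* m) ≈ 0ℤ
    motzkin-append-p-2 m central₁≈0 = begin
      + motzkin (w ℕ.+ p ℕ.* m)
        ≈⟨ motzkin-near-centre m w 1 (ℕ.+-comm w 2) 2≤p ⟩
      central m * (V (+ w) - V (+ w - + 2)) - central₁ m * V 0ℤ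
        ≈⟨ sub-cong (*-congˡ (central m) (sub-cong V[w]≈S V[w-2]≈S)) (*-congʳ (V 0ℤ) central₁≈0) ⟩
      central m * (S - S) - 0ℤ * V 0ℤ
        ≡⟨ simplify (central m) S (V 0ℤ) ⟩
      0ℤ ∎
      where
      open ≈-Reasoning
      simplify : ∀ a s t → a * (s - s) - 0ℤ * t ≡ 0ℤ
      simplify = solve-∀

    motzkin-append-p-1 : ∀ m → + 2 * central m + central₁ m ≈ 0ℤ → + motzkin (q ℕ.+ p ℕ.* m) ≈ 0ℤ
    motzkin-append-p-1 m pair≈0 = begin
      + motzkin (q ℕ.+ p ℕ.* m)
        ≈⟨ motzkin-near-centre m q 0 (ℕ.+-comm q 1) 2≤p ⟩
      central m * (U (+ q) - U (+ q - + 2)) - central₁ m * U (+ 1)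
        ≈⟨ sub-cong (*-congˡ (central m) (sub-cong U[q]≈1 U[q-2]≈-1)) (*-congˡ (central₁ m) U[1]≈-1) ⟩
      central m * (1ℤ - -1ℤ) - central₁ m * -1ℤ
        ≡⟨ simplify (central m) (central₁ m) ⟩
      + 2 * central m + central₁ m
        ≈⟨ pair≈0 ⟩
      0ℤ ∎
      where
      open ≈-Reasoning
      simplify : ∀ a b → a * (1ℤ - -1ℤ) - b * -1ℤ ≡ + 2 * a + b
      simplify = solve-∀

    append-digit : ∀ a k m → a ℕ.* p ℕ.^ k ≡ suc m → a ℕ.* p ℕ.^ suc k ≡ suc (q ℕ.+ p ℕ.* m)
    append-digit a k m a*pᵏ≡1+m = begin
      a ℕ.* (p ℕ.* p ℕ.^ k)     ≡⟨ swap a p (p ℕ.^ k) ⟩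
      p ℕ.* (a ℕ.* p ℕ.^ k)     ≡⟨ cong (p ℕ.*_) a*pᵏ≡1+m ⟩
      p ℕ.* suc m               ≡⟨ ℕ.*-suc p m ⟩
      suc (q ℕ.+ p ℕ.* m)       ∎
      where
      open ≡-Reasoning
      swap : ∀ a b c → a ℕ.* (b ℕ.* c) ≡ b ℕ.* (a ℕ.* c)
      swap = ℕ-Solver.solve-∀

    -- a pᵏ − 1 is a − 1 followed by k base-p digits p − 1.
    append-digits : (P : ℕ → Set) → (∀ m → P m → P (q ℕ.+ p ℕ.* m)) →
                    ∀ a m → a ≡ suc m → P m → ∀ k → ∃ λ m′ → a ℕ.* p ℕ.^ k ≡ suc m′ × P m′
    append-digits P step a m a≡1+m Pm zero    = m , trans (ℕ.*-identityʳ a) a≡1+m , Pm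
    append-digits P step a m a≡1+m Pm (suc k) with append-digits P step a m a≡1+m Pm k
    ... | m′ , a*pᵏ≡1+m′ , Pm′ = q ℕ.+ p ℕ.* m′ , append-digit a k m′ a*pᵏ≡1+m′ , step m′ Pm′

    case₁ : DividesMotzkin₁ p
    case₁ i (suc k) _ =
      let m , a*pᵏ≡1+m , central₁≈0 = append-digits (λ m → central₁ m ≈ 0ℤ) (λ m → ≈-trans (central₁-append-p-1 m))
                                                    (p ℕ.* i ℕ.+ 1) (p ℕ.* i) (ℕ.+-comm (p ℕ.* i) 1) (central₁-p* i) k
      in ≈0⇒∣ (subst (λ n → + motzkin n ≈ 0ℤ) (cong (ℕ._∸ 2) (sym (append-digit (p ℕ.* i ℕ.+ 1) k m a*pᵏ≡1+m)))
                     (motzkin-append-p-2 m central₁≈0))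

    balanced-append-p-2 : ∀ i → + 2 * central (w ℕ.+ p ℕ.* i) + central₁ (w ℕ.+ p ℕ.* i) ≈ 0ℤ
    balanced-append-p-2 i = ≈-trans (+-cong (*-congˡ (+ 2) (central-append-p-2 i)) (central₁-append-p-2 i))
                                    (≈-reflexive (cancel (central i) S))
      where cancel : ∀ c s → + 2 * (c * s) + c * - (s + s) ≡ 0ℤ
            cancel = solve-∀

    balanced-append-p-1 : ∀ m → + 2 * central m + central₁ m ≈ 0ℤ → + 2 * central (q ℕ.+ p ℕ.* m) + central₁ (q ℕ.+ p ℕ.* m) ≈ 0ℤ
    balanced-append-p-1 m = ≈-trans (+-cong (*-congˡ (+ 2) (central-append-p-1 m)) (central₁-append-p-1 m))

    p*i+p∸1≡1+[w+p*i] : ∀ i → p ℕ.* i ℕ.+ p ℕ.∸ 1 ≡ suc (w ℕ.+ p ℕ.* i)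
    p*i+p∸1≡1+[w+p*i] i = trans (cong (ℕ._∸ 1) (ℕ.+-suc (p ℕ.* i) q)) (ℕ.+-comm (p ℕ.* i) q)

    case₂ : DividesMotzkin₂ p
    case₂ i (suc k) _ =
      let m , a*pᵏ≡1+m , balanced = append-digits (λ m → + 2 * central m + central₁ m ≈ 0ℤ) balanced-append-p-1
                                                  (p ℕ.* i ℕ.+ p ℕ.∸ 1) (w ℕ.+ p ℕ.* i) (p*i+p∸1≡1+[w+p*i] i) (balanced-append-p-2 i) k
      in ≈0⇒∣ (subst (λ n → + motzkin n ≈ 0ℤ) (cong (ℕ._∸ 1) (sym (append-digit (p ℕ.* i ℕ.+ p ℕ.∸ 1) k m a*pᵏ≡1+m)))
                     (motzkin-append-p-1 m balanced))

  prime≡1[6]⇒≡4+3Q : ∀ p → Prime p → p ℕ.% 6 ≡ 1 → ∃ λ Q → p ≡ 4 ℕ.+ 3 ℕ.* Q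
  prime≡1[6]⇒≡4+3Q p p-prime p%6≡1 = from-quotient (p ℕ./ 6) (trans (ℕ.m≡m%n+[m/n]*n p 6) (cong (ℕ._+ p ℕ./ 6 ℕ.* 6) p%6≡1))
    where
    from-quotient : ∀ t → p ≡ 1 ℕ.+ t ℕ.* 6 → ∃ λ Q → p ≡ 4 ℕ.+ 3 ℕ.* Q
    from-quotient zero    p≡1   = ⊥-elim (¬prime[1] (subst Prime p≡1 p-prime))
    from-quotient (suc t) p≡7+6t = suc (2 ℕ.* t) , trans p≡7+6t (regroup t)
      where regroup : ∀ t → 1 ℕ.+ suc t ℕ.* 6 ≡ 4 ℕ.+ 3 ℕ.* suc (2 ℕ.* t)
            regroup = ℕ-Solver.solve-∀

  motzkin-divisibility : ∀ p → Prime p → p ℕ.% 6 ≡ 1 → DividesMotzkin₁ p × DividesMotzkin₂ p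
  motzkin-divisibility p p-prime p%6≡1 =
    let Q , p≡4+3Q = prime≡1[6]⇒≡4+3Q p p-prime p%6≡1
        prime′ = subst Prime p≡4+3Q p-prime
    in subst (λ p → DividesMotzkin₁ p × DividesMotzkin₂ p) (sym p≡4+3Q) (OneModThree.case₁ Q prime′ , OneModThree.case₂ Q prime′)

open import Data.Nat using (ℕ; _+_; _*_; _∸_; _^_; _≥_; _%_)
open import Data.Nat.Divisibility using (_∣_)
open import Data.Nat.Primality using (Prime)
open import Data.Product using (_×_)
open import Relation.Binary.PropositionalEquality using (_≡_)

mainTheorem2 : (p : ℕ) → Prime p → p % 6 ≡ 1 →
    ((i k : ℕ) → k ≥ 1 → p ∣ motzkin ((p * i + 1) * p ^ k ∸ 2))
    × ((i k : ℕ) → k ≥ 1 → p ∣ motzkin ((p * i + p ∸ 1) * p ^ k ∸ 1))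
mainTheorem2 = motzkin-divisibility
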